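{- Let $p$ be an odd prime, $n\ge1$, $\alpha\in(\mathbb Z/p^n)^\times$, $\varepsilon\in\{\pm1\}$ and integers $0\le b_1\le b_2\le n$. Let $D=\left\{\begin{pmatrix}\alpha^i&p^{b_1}j\\0&\varepsilon^i\end{pmatrix}:0\le i<o'_\alpha,\ 0\le j<p^{n-b_1}\right\}$ and $I=\left\{\begin{pmatrix}1&p^{b_2}j\\0&1\end{pmatrix}:0\le j<p^{n-b_2}\right\}$, acting by left multiplication on $W=\left\{\binom{x}{y}:x,y\in\mathbb Z/p^n,\ v(x)=0\text{ or }v(y)=0\right\}$. For $w=\binom{x}{y}\in W$, $$\#D\cdot w=\begin{cases}o_\alpha & y=0,\\ o_\varepsilon p^{n-b_1-v(y)} & v(x)\ge b_1+v(y),\\ o'_{\bar\alpha}\,p^{\max\{n-v_\alpha-v(x),\,n-b_1-v(y)\}} & v(x)<b_1+v(y),\ y\ne0,\end{cases}$$ and $\#I\cdot w=p^{\max\{n-b_2-v(y),0\}}$.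
   Context: For $x\in\mathbb Z/p^n$, $v(x)$ is the largest $e\le n$ with $p^e\mid x$ (so $v(0)=n$). $o_\alpha$ is the order of $\alpha$ in $(\mathbb Z/p^n)^\times$, $o_\varepsilon\in\{1,2\}$ the order of $\varepsilon$, $o'_\alpha=\mathrm{lcm}(o_\alpha,o_\varepsilon)$; $o_{\bar\alpha}$ is the order of $\alpha\bmod p$ in $\mathbb F_p^\times$, $o'_{\bar\alpha}=\mathrm{lcm}(o_{\bar\alpha},o_\varepsilon)$, and $v_\alpha=v(\alpha^{o_{\bar\alpha}}-1)$. -}

module Defs where

open import Data.Nat using (ℕ; zero; suc; _+_; _*_; _∸_; _^_; _≤_; _<_; _%_)
open import Data.Nat.Divisibility using (_∣_; _∣?_)
open import Data.Nat.Properties using (_≟_)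
open import Data.Product using (_×_; _,_)
open import Data.Product.Properties using (≡-dec)
open import Data.List using (List; length; map; upTo; cartesianProduct; deduplicate)
open import Relation.Nullary using (¬_; yes; no)
open import Relation.Binary.PropositionalEquality using (_≡_)

mod : ℕ → ℕ → ℕ
mod zero    x = x
mod (suc N) x = x % suc N

-- v(x) for x ∈ ℤ/p^n (x given by a representative): the largest e ≤ n
-- with p^e ∣ x.  (So v(0) = n.)
val : (p n x : ℕ) → ℕ
val p zero    x = zero
val p (suc n) x with p ^ suc n ∣? x
... | yes _ = suc n
... | no  _ = val p n x

IsOrder : (m a k : ℕ) → Set
IsOrder m a k =
  (1 ≤ k) × (mod m (a ^ k) ≡ mod m 1) ×
  (∀ j → 1 ≤ j → j < k → ¬ (mod m (a ^ j) ≡ mod m 1))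

card : List (ℕ × ℕ) → ℕ
card xs = length (deduplicate (≡-dec _≟_ _≟_) xs)

-- The orbit D·w, as the list of d·w for d = [[α^i, p^b₁ j],[0, ε^i]],
-- 0 ≤ i < o, 0 ≤ j < p^(n-b₁), reduced mod p^n.
orbitD : (p n α ε b₁ o x y : ℕ) → List (ℕ × ℕ)
orbitD p n α ε b₁ o x y =
  map (λ { (i , j) → ( mod (p ^ n) (α ^ i * x + p ^ b₁ * j * y)
                     , mod (p ^ n) (ε ^ i * y) ) })
      (cartesianProduct (upTo o) (upTo (p ^ (n ∸ b₁))))

orbitI : (p n b₂ x y : ℕ) → List (ℕ × ℕ)
orbitI p n b₂ x y =
  map (λ j → ( mod (p ^ n) (x + p ^ b₂ * j * y) , mod (p ^ n) y ))
      (upTo (p ^ (n ∸ b₂)))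

-- Write k = n − b₁ − v(y) and c = n − k = min(n, b₁ + v(y)).  The translations [[1, p^b₁ j],[0,1]]
-- move x through exactly the multiples of p^c, producing p^k distinct points, so |D·w| = K · p^k,
-- where K is the least d > 0 with α^d x ≡ x (mod p^c) and ε^d y ≡ y (mod p^n).  If y = 0 then x is a
-- unit and K = o_α.  If b₁ + v(y) ≤ v(x) the first condition is void and y is a unit, so K = o_ε.
-- Otherwise cancelling x turns the first condition into α^d ≡ 1 (mod p^(c − v(x))); by lifting the
-- exponent (p odd) its solutions are the multiples of o_ᾱ p^(c − v(x) − v_α), while ε = ±1 and
-- y ≢ 0 (mod p^n) make the second condition equivalent to o_ε ∣ d.  As p ∤ o_ε ∣ 2, this gives
-- K = lcm(o_ᾱ, o_ε) p^(c − v(x) − v_α), and (c − v(x) − v_α) + k = max(n − v_α − v(x), k).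
-- The I-orbit is the D-orbit for α = ε = 1.
module Submission where

open import Defs

open import Data.Empty using (⊥-elim)
open import Data.Integer using (ℤ; +_; ∣_∣; -1ℤ)
  renaming (_+_ to _+ᶻ_; _*_ to _*ᶻ_; _-_ to _-ᶻ_; -_ to -ᶻ_; _^_ to _^ᶻ_)
import Data.Integer.Properties as ℤ
open import Data.Integer.Divisibility.Signed as ℤ∣ using (divides) renaming (_∣_ to _∣ᶻ_)
open import Data.Integer.DivMod using (_%ℕ_; _/ℕ_; n%ℕd<d; a≡a%ℕn+[a/ℕn]*n)
open import Data.Integer.Tactic.RingSolver using (solve-∀)
open import Data.List using (List; []; _∷_; length; map; upTo; cartesianProduct; deduplicate)
open import Data.List.Membership.Propositional using (_∈_; _─_)
open import Data.List.Membership.Propositional.Properties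
  using (∈-map⁺; ∈-map⁻; ∈-deduplicate⁺; ∈-deduplicate⁻; ∈-upTo⁺; ∈-upTo⁻; ∈-cartesianProduct⁺; ∈-cartesianProduct⁻)
open import Data.List.Properties using (length-map; length-++; length-upTo; length-removeAt′; map-cong; map-∘; ++-identityʳ)
open import Data.List.Relation.Binary.Subset.Propositional using (_⊆_)
open import Data.List.Relation.Unary.All using (All; []; _∷_)
import Data.List.Relation.Unary.All as All
open import Data.List.Relation.Unary.AllPairs using ([]; _∷_)
open import Data.List.Relation.Unary.Any using (here; there)
open import Data.List.Relation.Unary.Unique.Propositional using (Unique)
import Data.List.Relation.Unary.Unique.Propositional.Properties as Unique
open import Data.List.Relation.Unary.Unique.DecPropositional.Properties using (deduplicate-!)
import Data.Nat
open import Data.Nat using (ℕ; zero; suc; _+_; _*_; _∸_; _^_; _≤_; _<_; _⊔_; z≤n; s≤s; NonZero; _%_; _/_)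
open import Data.Nat.Coprimality using (Coprime)
open import Data.Nat.Divisibility
  using (_∣_; divides; ∣-refl; ∣-trans; 1∣_; _∣?_; ∣⇒≤; m∣m*n; n∣m*n; ∣m+n∣m⇒∣n; ∣m⇒∣m*n; ∣n⇒∣m*n;
         *-monoʳ-∣; *-monoˡ-∣; *-cancelˡ-∣; *-cancelʳ-∣; ∣1⇒≡1; 0∣⇒≡0)
open import Data.Nat.DivMod using (m≡m%n+[m/n]*n; m%n<n; m%n%n≡m%n; m<n⇒m%n≡m; [m+kn]%n≡m%n)
open import Data.Nat.GCD using (gcd)
open import Data.Nat.LCM using (lcm; m∣lcm[m,n]; n∣lcm[m,n]; lcm-least; gcd*lcm)
open import Data.Nat.Primality using (Prime; euclidsLemma; prime⇒nonZero; prime⇒nonTrivial)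
open import Data.Nat.Properties
open import Data.Nat.Tactic.RingSolver renaming (solve-∀ to solve-∀ℕ)
open import Data.Product using (_×_; _,_; proj₁; proj₂; ∃)
open import Data.Product.Function.NonDependent.Propositional using (_×-⇔_)
open import Data.Product.Properties using (≡-dec)
import Data.Sum
open import Data.Sum using (_⊎_; inj₁; inj₂; [_,_]′)
open import Function.Base using (_∘_)
open import Function.Bundles using (_⇔_; mk⇔; Equivalence)
open import Function.Properties.Equivalence using (⇔-setoid)
open import Level using (0ℓ)
open import Relation.Binary.Bundles using (Setoid)
open import Relation.Binary.PropositionalEquality
import Relation.Binary.Reasoning.Setoid
open import Relation.Nullary using (¬_; yes; no)

-- Congruences of integers modulo a natural number

infix 4 _≡_[mod_]
record _≡_[mod_] (a b : ℤ) (m : ℕ) : Set where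
  constructor mod-by
  field divides-difference : + m ∣ᶻ a -ᶻ b
open _≡_[mod_] public

module _ {m : ℕ} where

  ≡-mod-refl : ∀ {a} → a ≡ a [mod m ]
  ≡-mod-refl {a} = mod-by (divides (+ 0) (trans (ℤ.+-inverseʳ a) (sym (ℤ.*-zeroˡ (+ m)))))

  ≡-mod-reflexive : ∀ {a b} → a ≡ b → a ≡ b [mod m ]
  ≡-mod-reflexive refl = ≡-mod-refl

  ≡-mod-sym : ∀ {a b} → a ≡ b [mod m ] → b ≡ a [mod m ]
  ≡-mod-sym {a} {b} (mod-by h) = mod-by (subst (_ ∣ᶻ_) (flip a b) (ℤ∣.∣m⇒∣-m h))
    where flip : ∀ a b → -ᶻ (a -ᶻ b) ≡ b -ᶻ a
          flip = solve-∀

  ≡-mod-trans : ∀ {a b c} → a ≡ b [mod m ] → b ≡ c [mod m ] → a ≡ c [mod m ]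
  ≡-mod-trans {a} {b} {c} (mod-by h) (mod-by h′) = mod-by (subst (_ ∣ᶻ_) (telescope a b c) (ℤ∣.∣m∣n⇒∣m+n h h′))
    where telescope : ∀ a b c → (a -ᶻ b) +ᶻ (b -ᶻ c) ≡ a -ᶻ c
          telescope = solve-∀

  ≡-mod-setoid : Setoid _ _
  ≡-mod-setoid = record
    { Carrier = ℤ
    ; _≈_ = _≡_[mod m ]
    ; isEquivalence = record { refl = ≡-mod-refl ; sym = ≡-mod-sym ; trans = ≡-mod-trans }
    }

  +-cong-mod : ∀ {a b c d} → a ≡ b [mod m ] → c ≡ d [mod m ] → a +ᶻ c ≡ b +ᶻ d [mod m ]
  +-cong-mod {a} {b} {c} {d} (mod-by h) (mod-by h′) = mod-by (subst (_ ∣ᶻ_) (regroup a b c d) (ℤ∣.∣m∣n⇒∣m+n h h′))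
    where regroup : ∀ a b c d → (a -ᶻ b) +ᶻ (c -ᶻ d) ≡ (a +ᶻ c) -ᶻ (b +ᶻ d)
          regroup = solve-∀

  *-congʳ-mod : ∀ {a b} c → a ≡ b [mod m ] → a *ᶻ c ≡ b *ᶻ c [mod m ]
  *-congʳ-mod {a} {b} c (mod-by h) = mod-by (subst (_ ∣ᶻ_) (distrib a b c) (ℤ∣.∣m⇒∣m*n c h))
    where distrib : ∀ a b c → (a -ᶻ b) *ᶻ c ≡ a *ᶻ c -ᶻ b *ᶻ c
          distrib = solve-∀

  *-congˡ-mod : ∀ {a b} c → a ≡ b [mod m ] → c *ᶻ a ≡ c *ᶻ b [mod m ]
  *-congˡ-mod {a} {b} c h = subst₂ _≡_[mod m ] (ℤ.*-comm a c) (ℤ.*-comm b c) (*-congʳ-mod c h)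

  *-cong-mod : ∀ {a b c d} → a ≡ b [mod m ] → c ≡ d [mod m ] → a *ᶻ c ≡ b *ᶻ d [mod m ]
  *-cong-mod {b = b} {c = c} h h′ = ≡-mod-trans (*-congʳ-mod c h) (*-congˡ-mod b h′)

  ^-cong-mod : ∀ {a b} k → a ≡ b [mod m ] → a ^ᶻ k ≡ b ^ᶻ k [mod m ]
  ^-cong-mod zero    h = ≡-mod-refl
  ^-cong-mod (suc k) h = *-cong-mod h (^-cong-mod k h)

module ≡-mod-Reasoning (m : ℕ) where
  open import Relation.Binary.Reasoning.Setoid (≡-mod-setoid {m}) public

module ⇔-Reasoning = Relation.Binary.Reasoning.Setoid (⇔-setoid 0ℓ)

≡-mod-∣ : ∀ {m k a b} → m ∣ k → a ≡ b [mod k ] → a ≡ b [mod m ]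
≡-mod-∣ m∣k (mod-by h) = mod-by (ℤ∣.∣-trans (ℤ∣.∣ᵤ⇒∣ m∣k) h)

+-cancelˡ-mod : ∀ {m} c {a b} → c +ᶻ a ≡ c +ᶻ b [mod m ] → a ≡ b [mod m ]
+-cancelˡ-mod c {a} {b} (mod-by h) = mod-by (subst (_ ∣ᶻ_) (cancel c a b) h)
  where cancel : ∀ c a b → (c +ᶻ a) -ᶻ (c +ᶻ b) ≡ a -ᶻ b
        cancel = solve-∀

+-congˡ-mod : ∀ {m} c {a b} → a ≡ b [mod m ] → c +ᶻ a ≡ c +ᶻ b [mod m ]
+-congˡ-mod c = +-cong-mod (≡-mod-refl {a = c})

+-≡-mod⇔∣ : ∀ {m} a b → (+ (a + b) ≡ + a [mod m ]) ⇔ (m ∣ b)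
+-≡-mod⇔∣ {m} a b = mk⇔ (λ h → subst (m ∣_) (cong ∣_∣ difference) (ℤ∣.∣⇒∣ᵤ (divides-difference h)))
                       (λ h → mod-by (subst (+ m ∣ᶻ_) (sym difference) (ℤ∣.∣ᵤ⇒∣ h)))
  where
  cancel : ∀ a b → (a +ᶻ b) -ᶻ a ≡ b
  cancel = solve-∀
  difference : + (a + b) -ᶻ + a ≡ + b
  difference = trans (cong (_-ᶻ + a) (ℤ.pos-+ a b)) (cancel (+ a) (+ b))

mod≡% : ∀ m .{{_ : NonZero m}} x → mod m x ≡ x % m
mod≡% (suc m) x = refl

≡-mod-% : ∀ m .{{_ : NonZero m}} a → + a ≡ + (a % m) [mod m ]
≡-mod-% m a = subst (λ t → + t ≡ + (a % m) [mod m ]) (sym (m≡m%n+[m/n]*n a m))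
                 (Equivalence.from (+-≡-mod⇔∣ (a % m) (a / m * m)) (divides (a / m) refl))

%≡⇒≡-mod : ∀ m .{{_ : NonZero m}} a b → a % m ≡ b % m → + a ≡ + b [mod m ]
%≡⇒≡-mod m a b eq = begin
  + a         ≈⟨ ≡-mod-% m a ⟩
  + (a % m)   ≡⟨ cong +_ eq ⟩
  + (b % m)   ≈⟨ ≡-mod-sym (≡-mod-% m b) ⟩
  + b         ∎
  where open ≡-mod-Reasoning m

≡-mod⇒%≡ : ∀ m .{{_ : NonZero m}} a b → + a ≡ + b [mod m ] → a % m ≡ b % m
≡-mod⇒%≡ m a b h = [ (λ b≤a → ordered b≤a h) , (λ a≤b → sym (ordered a≤b (≡-mod-sym h))) ]′ (≤-total b a)
  where
  ordered : ∀ {a b} → b ≤ a → + a ≡ + b [mod m ] → a % m ≡ b % m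
  ordered {a} {b} b≤a h with Equivalence.to (+-≡-mod⇔∣ b (a ∸ b)) (subst (λ t → + t ≡ + b [mod m ]) (sym (m+[n∸m]≡n b≤a)) h)
  ... | divides k eq = trans (cong (_% m) (trans (sym (m+[n∸m]≡n b≤a)) (cong (_+_ b) eq))) ([m+kn]%n≡m%n b k m)

mod≡⇔≡-mod : ∀ m .{{_ : NonZero m}} a b → (mod m a ≡ mod m b) ⇔ (+ a ≡ + b [mod m ])
mod≡⇔≡-mod m a b = mk⇔
  (λ eq → %≡⇒≡-mod m a b (trans (sym (mod≡% m a)) (trans eq (mod≡% m b))))
  (λ h → trans (mod≡% m a) (trans (≡-mod⇒%≡ m a b h) (sym (mod≡% m b))))

≡-mod-<⇒≡ : ∀ {m a b} → + a ≡ + b [mod m ] → a < m → b < m → a ≡ b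
≡-mod-<⇒≡ {suc m} {a} {b} h a<m b<m =
  trans (sym (m<n⇒m%n≡m a<m)) (trans (≡-mod⇒%≡ (suc m) a b h) (m<n⇒m%n≡m b<m))

≡-mod⇔∣∣-∣ : ∀ {m a b} → (a ≡ b [mod m ]) ⇔ (m ∣ ∣ a -ᶻ b ∣)
≡-mod⇔∣∣-∣ = mk⇔ (λ h → ℤ∣.∣⇒∣ᵤ (divides-difference h)) (λ h → mod-by (ℤ∣.∣ᵤ⇒∣ h))

*ʳ-≡-mod⇔∣ : ∀ {m} a b x → (a *ᶻ + x ≡ b *ᶻ + x [mod m ]) ⇔ (m ∣ ∣ a -ᶻ b ∣ * x)
*ʳ-≡-mod⇔∣ {m} a b x = mk⇔
  (λ h → subst (m ∣_) absolute (Equivalence.to ≡-mod⇔∣∣-∣ h))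
  (λ h → Equivalence.from ≡-mod⇔∣∣-∣ (subst (m ∣_) (sym absolute) h))
  where
  distrib : ∀ a b x → a *ᶻ x -ᶻ b *ᶻ x ≡ (a -ᶻ b) *ᶻ x
  distrib = solve-∀
  absolute : ∣ a *ᶻ + x -ᶻ b *ᶻ + x ∣ ≡ ∣ a -ᶻ b ∣ * x
  absolute = trans (cong ∣_∣ (distrib a b (+ x))) (ℤ.abs-* (a -ᶻ b) (+ x))

lift-≡-mod : ∀ c M .{{_ : NonZero M}} {a b} → a ≡ b [mod c ] → ∃ λ m → m < M × a ≡ b +ᶻ + c *ᶻ + m [mod c * M ]
lift-≡-mod c M {a} {b} (mod-by (divides t a-b≡t*c)) = t %ℕ M , n%ℕd<d t M , mod-by (divides (t /ℕ M) (begin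
  a -ᶻ (b +ᶻ + c *ᶻ + (t %ℕ M))                          ≡⟨ regroup a b (+ c) (+ (t %ℕ M)) ⟩
  (a -ᶻ b) -ᶻ + c *ᶻ + (t %ℕ M)                          ≡⟨ cong (λ s → s -ᶻ + c *ᶻ + (t %ℕ M)) a-b≡t*c ⟩
  t *ᶻ + c -ᶻ + c *ᶻ + (t %ℕ M)                          ≡⟨ cong (λ s → s *ᶻ + c -ᶻ + c *ᶻ + (t %ℕ M)) (a≡a%ℕn+[a/ℕn]*n t M) ⟩
  (+ (t %ℕ M) +ᶻ t /ℕ M *ᶻ + M) *ᶻ + c -ᶻ + c *ᶻ + (t %ℕ M) ≡⟨ quotient (+ (t %ℕ M)) (t /ℕ M) (+ M) (+ c) ⟩
  t /ℕ M *ᶻ (+ c *ᶻ + M)                                 ≡⟨ cong (t /ℕ M *ᶻ_) (ℤ.pos-* c M) ⟨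
  t /ℕ M *ᶻ + (c * M)                                    ∎))
  where
  open ≡-Reasoning
  regroup : ∀ a b c m → a -ᶻ (b +ᶻ c *ᶻ m) ≡ (a -ᶻ b) -ᶻ c *ᶻ m
  regroup = solve-∀
  quotient : ∀ m q M c → (m +ᶻ q *ᶻ M) *ᶻ c -ᶻ c *ᶻ m ≡ q *ᶻ (c *ᶻ M)
  quotient = solve-∀

pos-^ : ∀ a k → + (a ^ k) ≡ (+ a) ^ᶻ k
pos-^ a zero    = refl
pos-^ a (suc k) = trans (ℤ.pos-* a (a ^ k)) (cong (+ a *ᶻ_) (pos-^ a k))

pos-^* : ∀ a i x → + (a ^ i * x) ≡ (+ a) ^ᶻ i *ᶻ + x
pos-^* a i x = trans (ℤ.pos-* (a ^ i) x) (cong (_*ᶻ + x) (pos-^ a i))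

pos-^*+ : ∀ a i x t → + (a ^ i * x + t) ≡ (+ a) ^ᶻ i *ᶻ + x +ᶻ + t
pos-^*+ a i x t = trans (ℤ.pos-+ (a ^ i * x) t) (cong (_+ᶻ + t) (pos-^* a i x))

-- p-adic valuation

^-monoʳ-∣ : ∀ p {m n} → m ≤ n → p ^ m ∣ p ^ n
^-monoʳ-∣ p {m} {n} m≤n = divides (p ^ (n ∸ m)) (trans (cong (p ^_) (sym (m∸n+n≡m m≤n))) (^-distribˡ-+-* p (n ∸ m) m))

p∣p^ : ∀ p {n} → 1 ≤ n → p ∣ p ^ n
p∣p^ p {n} n≥1 = subst (_∣ p ^ n) (*-identityʳ p) (^-monoʳ-∣ p n≥1)

^-∸-cancelˡ-∣ : ∀ p .{{_ : NonZero p}} e b {m} → p ^ e ∣ p ^ b * m → p ^ (e ∸ b) ∣ m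
^-∸-cancelˡ-∣ p e b {m} h with e ≤? b
... | yes e≤b = subst (_∣ m) (cong (p ^_) (sym (m≤n⇒m∸n≡0 e≤b))) (1∣ m)
... | no  e≰b = *-cancelˡ-∣ (p ^ b) {{m^n≢0 p b}} (subst (_∣ p ^ b * m) split h)
  where split : p ^ e ≡ p ^ b * p ^ (e ∸ b)
        split = trans (cong (p ^_) (sym (m+[n∸m]≡n (≰⇒≥ e≰b)))) (^-distribˡ-+-* p b (e ∸ b))

^-∸-∣⇒∣^-* : ∀ p e b {m} → p ^ (e ∸ b) ∣ m → p ^ e ∣ p ^ b * m
^-∸-∣⇒∣^-* p e b {m} h = ∣-trans (^-monoʳ-∣ p (m≤n+m∸n e b))
                           (subst (_∣ p ^ b * m) (sym (^-distribˡ-+-* p b (e ∸ b))) (*-monoʳ-∣ (p ^ b) h))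

module _ (p : ℕ) where

  val≤n : ∀ n x → val p n x ≤ n
  val≤n zero    x = z≤n
  val≤n (suc n) x with p ^ suc n ∣? x
  ... | yes _ = ≤-refl
  ... | no  _ = m≤n⇒m≤1+n (val≤n n x)

  p^val∣ : ∀ n x → p ^ val p n x ∣ x
  p^val∣ zero    x = divides x (sym (*-identityʳ x))
  p^val∣ (suc n) x with p ^ suc n ∣? x
  ... | yes h = h
  ... | no  _ = p^val∣ n x

  p^[1+val]∤ : ∀ n x → val p n x < n → ¬ p ^ suc (val p n x) ∣ x
  p^[1+val]∤ (suc n) x v<n with p ^ suc n ∣? x
  ... | yes _ = ⊥-elim (<-irrefl refl v<n)
  ... | no  h with val p n x <? n
  ...   | yes v<n′ = p^[1+val]∤ n x v<n′
  ...   | no  v≮n  = subst (λ v → ¬ p ^ suc v ∣ x) (sym (≤-antisym (val≤n n x) (≮⇒≥ v≮n))) h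

  val-0 : ∀ n → val p n 0 ≡ n
  val-0 zero = refl
  val-0 (suc n) with p ^ suc n ∣? 0
  ... | yes _ = refl
  ... | no  h = ⊥-elim (h (divides 0 refl))

  val≡n⇒≡0 : ∀ n {x} .{{_ : NonZero p}} → x < p ^ n → val p n x ≡ n → x ≡ 0
  val≡n⇒≡0 n {zero}  _   _  = refl
  val≡n⇒≡0 n {suc x} x<N eq = ⊥-elim (<⇒≱ x<N (subst (λ v → p ^ v ≤ suc x) eq (∣⇒≤ (p^val∣ n (suc x)))))

  unit-part : ∀ n x → ∃ λ u → x ≡ p ^ val p n x * u × (val p n x < n → ¬ p ∣ u)
  unit-part n x with p^val∣ n x
  ... | divides u eq = u , trans eq (*-comm u _) , λ v<n p∣u → p^[1+val]∤ n x v<n (lift p∣u)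
    where lift : p ∣ u → p ^ suc (val p n x) ∣ x
          lift (divides w refl) = divides w (trans eq (*-assoc w p _))

  ∣-val-*ʳ : ∀ n e x {m} → p ^ (e ∸ val p n x) ∣ m → p ^ e ∣ m * x
  ∣-val-*ʳ n e x {m} h with unit-part n x
  ... | u , x≡ , _ = subst (p ^ e ∣_) (sym regroup) (∣-trans (^-∸-∣⇒∣^-* p e v h) (m∣m*n u))
    where
    v = val p n x
    regroup : m * x ≡ p ^ v * m * u
    regroup = trans (cong (m *_) x≡) (reorder m (p ^ v) u)
      where reorder : ∀ m q u → m * (q * u) ≡ q * m * u
            reorder = solve-∀ℕ

≡-mod-val-*ʳ : ∀ p n e x {a b} → a ≡ b [mod p ^ (e ∸ val p n x) ] → a *ᶻ + x ≡ b *ᶻ + x [mod p ^ e ]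
≡-mod-val-*ʳ p n e x {a} {b} h =
  Equivalence.from (*ʳ-≡-mod⇔∣ a b x) (∣-val-*ʳ p n e x (Equivalence.to ≡-mod⇔∣∣-∣ h))

≡-mod-^-cancelʳ : ∀ p .{{_ : NonZero p}} e b {a c} → a *ᶻ + (p ^ b) ≡ c *ᶻ + (p ^ b) [mod p ^ e ] → a ≡ c [mod p ^ (e ∸ b) ]
≡-mod-^-cancelʳ p e b {a} {c} h = Equivalence.from ≡-mod⇔∣∣-∣
  (^-∸-cancelˡ-∣ p e b (subst (p ^ e ∣_) (*-comm _ (p ^ b)) (Equivalence.to (*ʳ-≡-mod⇔∣ a c (p ^ b)) h)))

-- Multiplicative orders

module _ (m : ℕ) .{{_ : NonZero m}} {a k : ℕ} (order : IsOrder m a k) where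

  ^order≡1 : (+ a) ^ᶻ k ≡ + 1 [mod m ]
  ^order≡1 = subst (_≡ + 1 [mod m ]) (pos-^ a k) (Equivalence.to (mod≡⇔≡-mod m (a ^ k) 1) (proj₁ (proj₂ order)))

  ^multiple≡1 : ∀ q → (+ a) ^ᶻ (q * k) ≡ + 1 [mod m ]
  ^multiple≡1 q = begin
    (+ a) ^ᶻ (q * k)   ≡⟨ cong ((+ a) ^ᶻ_) (*-comm q k) ⟩
    (+ a) ^ᶻ (k * q)   ≡⟨ ℤ.^-*-assoc (+ a) k q ⟨
    ((+ a) ^ᶻ k) ^ᶻ q  ≈⟨ ^-cong-mod q ^order≡1 ⟩
    (+ 1) ^ᶻ q         ≡⟨ ℤ.^-zeroˡ q ⟩
    + 1                ∎
    where open ≡-mod-Reasoning m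

  ^≡1⇔order∣ : ∀ d → ((+ a) ^ᶻ d ≡ + 1 [mod m ]) ⇔ (k ∣ d)
  ^≡1⇔order∣ d = mk⇔ order∣ (λ { (divides q refl) → ^multiple≡1 q })
    where
    instance
      k≢0 : NonZero k
      k≢0 = Data.Nat.>-nonZero (proj₁ order)
    r = d % k
    q = d / k
    remainder≡1 : (+ a) ^ᶻ d ≡ + 1 [mod m ] → (+ a) ^ᶻ r ≡ + 1 [mod m ]
    remainder≡1 h = begin
      (+ a) ^ᶻ r                        ≡⟨ ℤ.*-identityʳ _ ⟨
      (+ a) ^ᶻ r *ᶻ + 1                 ≈⟨ *-congˡ-mod ((+ a) ^ᶻ r) (^multiple≡1 q) ⟨
      (+ a) ^ᶻ r *ᶻ (+ a) ^ᶻ (q * k)    ≡⟨ ℤ.^-distribˡ-+-* (+ a) r (q * k) ⟨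
      (+ a) ^ᶻ (r + q * k)              ≡⟨ cong ((+ a) ^ᶻ_) (m≡m%n+[m/n]*n d k) ⟨
      (+ a) ^ᶻ d                        ≈⟨ h ⟩
      + 1                               ∎
      where open ≡-mod-Reasoning m
    minimal : ∀ r → r < k → (+ a) ^ᶻ r ≡ + 1 [mod m ] → r ≡ 0
    minimal zero    _   _ = refl
    minimal (suc r) r<k h = ⊥-elim (proj₂ (proj₂ order) (suc r) (s≤s z≤n) r<k
      (Equivalence.from (mod≡⇔≡-mod m (a ^ suc r) 1) (subst (_≡ + 1 [mod m ]) (sym (pos-^ a (suc r))) h)))
    order∣ : (+ a) ^ᶻ d ≡ + 1 [mod m ] → k ∣ d
    order∣ h = divides q (trans (m≡m%n+[m/n]*n d k) (cong (_+ q * k) (minimal r (m%n<n d k) (remainder≡1 h))))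

^*≡⇐order∣ : ∀ m .{{_ : NonZero m}} {a o} → IsOrder m a o → ∀ {d} X → o ∣ d → (+ a) ^ᶻ d *ᶻ X ≡ X [mod m ]
^*≡⇐order∣ m order {d} X o∣d =
  ≡-mod-trans (*-congʳ-mod X (Equivalence.from (^≡1⇔order∣ m order d) o∣d)) (≡-mod-reflexive (ℤ.*-identityˡ X))

^-period-shift : ∀ {m} (A X : ℤ) r d → A ^ᶻ d *ᶻ X ≡ X [mod m ] → A ^ᶻ (r + d) *ᶻ X ≡ A ^ᶻ r *ᶻ X [mod m ]
^-period-shift {m} A X r d h = begin
  A ^ᶻ (r + d) *ᶻ X       ≡⟨ cong (_*ᶻ X) (ℤ.^-distribˡ-+-* A r d) ⟩
  A ^ᶻ r *ᶻ A ^ᶻ d *ᶻ X   ≡⟨ ℤ.*-assoc (A ^ᶻ r) _ X ⟩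
  A ^ᶻ r *ᶻ (A ^ᶻ d *ᶻ X) ≈⟨ *-congˡ-mod (A ^ᶻ r) h ⟩
  A ^ᶻ r *ᶻ X             ∎
  where open ≡-mod-Reasoning m

-- Cancellation modulo prime powers

module _ {p : ℕ} (p-prime : Prime p) where

  private instance
    p≢0 : NonZero p
    p≢0 = prime⇒nonZero p-prime

  ¬p∣1 : ¬ p ∣ 1
  ¬p∣1 h = <-irrefl (sym (∣1⇒≡1 h)) (Data.Nat.nonTrivial⇒n>1 p {{prime⇒nonTrivial p-prime}})

  ¬p∣⇒¬p∣^ : ∀ {a} → ¬ p ∣ a → ∀ k → ¬ p ∣ a ^ k
  ¬p∣⇒¬p∣^ p∤a zero    = ¬p∣1
  ¬p∣⇒¬p∣^ {a} p∤a (suc k) h = [ p∤a , ¬p∣⇒¬p∣^ p∤a k ]′ (euclidsLemma a (a ^ k) p-prime h)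

  ^-∣-*-cancelʳ : ∀ k {m u} → ¬ p ∣ u → p ^ k ∣ m * u → p ^ k ∣ m
  ^-∣-*-cancelʳ zero    {m} p∤u h = 1∣ m
  ^-∣-*-cancelʳ (suc k) {m} {u} p∤u h with euclidsLemma m u p-prime (∣-trans (m∣m*n (p ^ k)) h)
  ... | inj₂ p∣u = ⊥-elim (p∤u p∣u)
  ... | inj₁ (divides m′ refl) = subst (p ^ suc k ∣_) (*-comm p m′)
    (*-monoʳ-∣ p (^-∣-*-cancelʳ k p∤u (*-cancelˡ-∣ p (subst (p * p ^ k ∣_) (regroup m′ p u) h))))
    where regroup : ∀ m′ p u → m′ * p * u ≡ p * (m′ * u)
          regroup = solve-∀ℕ

  p*-∣-cancel⇔ : ∀ {a b} → (p * a ∣ p * b) ⇔ (a ∣ b)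
  p*-∣-cancel⇔ = mk⇔ (*-cancelˡ-∣ p) (*-monoʳ-∣ p)

  unit*-∣-cancel⇔ : ∀ k {w m} → ¬ p ∣ w → (p ^ k ∣ w * m) ⇔ (p ^ k ∣ m)
  unit*-∣-cancel⇔ k {w} {m} p∤w = mk⇔ (λ h → ^-∣-*-cancelʳ k p∤w (subst (p ^ k ∣_) (*-comm w m) h)) (∣n⇒∣m*n w)

  ∣-*-val-cancelʳ : ∀ n e x {m} → e ≤ n → p ^ e ∣ m * x → p ^ (e ∸ val p n x) ∣ m
  ∣-*-val-cancelʳ n e x {m} e≤n h with unit-part p n x | e ≤? val p n x
  ... | _ | yes e≤v = subst (_∣ m) (cong (p ^_) (sym (m≤n⇒m∸n≡0 e≤v))) (1∣ m)
  ... | u , x≡ , unit | no e≰v =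
    ^-∣-*-cancelʳ (e ∸ v) (unit (<-≤-trans (≰⇒> e≰v) e≤n)) (^-∸-cancelˡ-∣ p e v (subst (p ^ e ∣_) regroup h))
    where
    v = val p n x
    regroup : m * x ≡ p ^ v * (m * u)
    regroup = trans (cong (m *_) x≡) (reorder m (p ^ v) u)
      where reorder : ∀ m q u → m * (q * u) ≡ q * (m * u)
            reorder = solve-∀ℕ

  ≡-mod-val-cancelʳ : ∀ n e x {a b} → e ≤ n → a *ᶻ + x ≡ b *ᶻ + x [mod p ^ e ] → a ≡ b [mod p ^ (e ∸ val p n x) ]
  ≡-mod-val-cancelʳ n e x {a} {b} e≤n h =
    Equivalence.from ≡-mod⇔∣∣-∣ (∣-*-val-cancelʳ n e x e≤n (Equivalence.to (*ʳ-≡-mod⇔∣ a b x) h))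

  ≡-mod-unit-cancelʳ : ∀ k u {a b} → ¬ p ∣ u → a *ᶻ + u ≡ b *ᶻ + u [mod p ^ k ] → a ≡ b [mod p ^ k ]
  ≡-mod-unit-cancelʳ k u {a} {b} p∤u h =
    Equivalence.from ≡-mod⇔∣∣-∣ (^-∣-*-cancelʳ k p∤u (Equivalence.to (*ʳ-≡-mod⇔∣ a b u) h))

  ^-period-unshift : ∀ {e a} → ¬ p ∣ a → ∀ X r d →
                     (+ a) ^ᶻ (r + d) *ᶻ X ≡ (+ a) ^ᶻ r *ᶻ X [mod p ^ e ] → (+ a) ^ᶻ d *ᶻ X ≡ X [mod p ^ e ]
  ^-period-unshift {e} {a} p∤a X r d h =
    ≡-mod-unit-cancelʳ e (a ^ r) (¬p∣⇒¬p∣^ p∤a r) (subst₂ _≡_[mod p ^ e ] (split r d) (commute r) h)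
    where
    swap : ∀ s t x → s *ᶻ t *ᶻ x ≡ t *ᶻ x *ᶻ s
    swap = solve-∀
    split : ∀ r d → (+ a) ^ᶻ (r + d) *ᶻ X ≡ (+ a) ^ᶻ d *ᶻ X *ᶻ + (a ^ r)
    split r d = trans (cong (_*ᶻ X) (ℤ.^-distribˡ-+-* (+ a) r d))
                  (trans (swap ((+ a) ^ᶻ r) _ X) (cong ((+ a) ^ᶻ d *ᶻ X *ᶻ_) (sym (pos-^ a r))))
    commute : ∀ r → (+ a) ^ᶻ r *ᶻ X ≡ X *ᶻ + (a ^ r)
    commute r = trans (ℤ.*-comm _ X) (cong (X *ᶻ_) (sym (pos-^ a r)))

  *x≡x⇔≡1 : ∀ n e x (A : ℤ) → e ≤ n → (A *ᶻ + x ≡ + x [mod p ^ e ]) ⇔ (A ≡ + 1 [mod p ^ (e ∸ val p n x) ])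
  *x≡x⇔≡1 n e x A e≤n = mk⇔
    (λ h → ≡-mod-val-cancelʳ n e x e≤n (≡-mod-trans h (≡-mod-reflexive (sym (ℤ.*-identityˡ (+ x))))))
    (λ h → ≡-mod-trans (≡-mod-val-*ʳ p n e x h) (≡-mod-reflexive (ℤ.*-identityˡ (+ x))))

  ^*x≡x⇔order∣ : ∀ n {a o x} → IsOrder (p ^ n) a o → val p n x ≡ 0 → ∀ d → ((+ a) ^ᶻ d *ᶻ + x ≡ + x [mod p ^ n ]) ⇔ (o ∣ d)
  ^*x≡x⇔order∣ n {a} {o} {x} order vx≡0 d = begin
    ((+ a) ^ᶻ d *ᶻ + x ≡ + x [mod p ^ n ])            ≈⟨ *x≡x⇔≡1 n n x _ ≤-refl ⟩
    ((+ a) ^ᶻ d ≡ + 1 [mod p ^ (n ∸ val p n x) ])     ≡⟨ cong (λ v → (+ a) ^ᶻ d ≡ + 1 [mod p ^ (n ∸ v) ]) vx≡0 ⟩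
    ((+ a) ^ᶻ d ≡ + 1 [mod p ^ n ])                   ≈⟨ ^≡1⇔order∣ (p ^ n) {{m^n≢0 p n}} order d ⟩
    (o ∣ d)                                           ∎
    where open ⇔-Reasoning

-- Lifting the exponent

geometric : ℕ → ℕ → ℕ
geometric z zero    = 0
geometric z (suc q) = 1 + (1 + z) * geometric z q

[1+z]^≡1+z*geometric : ∀ z q → (1 + z) ^ q ≡ 1 + z * geometric z q
[1+z]^≡1+z*geometric z zero    = sym (cong suc (*-zeroʳ z))
[1+z]^≡1+z*geometric z (suc q) = trans (cong ((1 + z) *_) ([1+z]^≡1+z*geometric z q)) (expand z (geometric z q))
  where expand : ∀ z s → (1 + z) * (1 + z * s) ≡ 1 + z * (1 + (1 + z) * s)
        expand = solve-∀ℕ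

geometric-+ : ∀ z a b → geometric z (a + b) ≡ geometric z a + (1 + z) ^ a * geometric z b
geometric-+ z zero    b = sym (+-identityʳ (geometric z b))
geometric-+ z (suc a) b = trans (cong (λ s → 1 + (1 + z) * s) (geometric-+ z a b)) (expand z (geometric z a) ((1 + z) ^ a) (geometric z b))
  where expand : ∀ z s t u → 1 + (1 + z) * (s + t * u) ≡ 1 + (1 + z) * s + (1 + z) * t * u
        expand = solve-∀ℕ

geometric-* : ∀ z a b → geometric z (a * b) ≡ geometric z a * geometric (z * geometric z a) b
geometric-* z a zero    = trans (cong (geometric z) (*-zeroʳ a)) (sym (*-zeroʳ (geometric z a)))
geometric-* z a (suc b) = begin
  geometric z (a * suc b)                                        ≡⟨ cong (geometric z) (*-suc a b) ⟩
  geometric z (a + a * b)                                        ≡⟨ geometric-+ z a (a * b) ⟩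
  geometric z a + (1 + z) ^ a * geometric z (a * b)              ≡⟨ cong₂ (λ u v → geometric z a + u * v) ([1+z]^≡1+z*geometric z a) (geometric-* z a b) ⟩
  s + (1 + z * s) * (s * geometric (z * s) b)                    ≡⟨ factor s (z * s) (geometric (z * s) b) ⟩
  s * geometric (z * s) (suc b)                                  ∎
  where
  open ≡-Reasoning
  s = geometric z a
  factor : ∀ s y t → s + (1 + y) * (s * t) ≡ s * (1 + (1 + y) * t)
  factor = solve-∀ℕ

triangular : ℕ → ℕ
triangular zero    = 0
triangular (suc q) = triangular q + q

triangular*2+q≡q*q : ∀ q → triangular q * 2 + q ≡ q * q
triangular*2+q≡q*q zero    = refl
triangular*2+q≡q*q (suc q) = trans (expand (triangular q) q) (trans (cong (λ t → t + 2 * q + 1) (triangular*2+q≡q*q q)) (square q))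
  where expand : ∀ t q → (t + q) * 2 + suc q ≡ t * 2 + q + 2 * q + 1
        expand = solve-∀ℕ
        square : ∀ q → q * q + 2 * q + 1 ≡ suc q * suc q
        square = solve-∀ℕ

geometric≡+z*triangular+z²* : ∀ z q → ∃ λ h → geometric z q ≡ q + z * triangular q + z * z * h
geometric≡+z*triangular+z²* z zero    = 0 , trans (sym (*-zeroʳ (z * z))) (sym (cong (_+ z * z * 0) (*-zeroʳ z)))
geometric≡+z*triangular+z²* z (suc q) with geometric≡+z*triangular+z²* z q
... | h , eq = triangular q + h + z * h , trans (cong (λ s → 1 + (1 + z) * s) eq) (expand z q (triangular q) h)
  where expand : ∀ z q t h → 1 + (1 + z) * (q + z * t + z * z * h) ≡ (1 + q) + z * (t + q) + z * z * (t + h + z * h)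
        expand = solve-∀ℕ

-1^≡±1 : ∀ d → -1ℤ ^ᶻ d ≡ + 1 ⊎ -1ℤ ^ᶻ d ≡ -1ℤ
-1^≡±1 zero = inj₁ refl
-1^≡±1 (suc d) with -1^≡±1 d
... | inj₁ eq = inj₂ (cong (-1ℤ *ᶻ_) eq)
... | inj₂ eq = inj₁ (cong (-1ℤ *ᶻ_) eq)

module _ {p : ℕ} (p-prime : Prime p) (p-odd : ¬ 2 ∣ p) where

  private instance
    p≢0 : NonZero p
    p≢0 = prime⇒nonZero p-prime

  ¬p∣2 : ¬ p ∣ 2
  ¬p∣2 p∣2 with ≤-antisym (∣⇒≤ p∣2) (Data.Nat.nonTrivial⇒n>1 p {{prime⇒nonTrivial p-prime}})
  ... | refl = p-odd (divides 1 refl)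

  p∣triangular : p ∣ triangular p
  p∣triangular = [ (λ h → h) , (λ h → ⊥-elim (¬p∣2 h)) ]′ (euclidsLemma (triangular p) 2 p-prime p∣triangular*2)
    where p∣triangular*2 : p ∣ triangular p * 2
          p∣triangular*2 = ∣m+n∣m⇒∣n (subst (p ∣_) (trans (sym (triangular*2+q≡q*q p)) (+-comm _ p)) (m∣m*n p))
                                     (divides 1 (sym (*-identityˡ p)))

  geometric-p≡p*unit : ∀ {z} → p ∣ z → ∃ λ w → geometric z p ≡ p * w × ¬ p ∣ w
  geometric-p≡p*unit (divides z′ refl) with geometric≡+z*triangular+z²* (z′ * p) p | p∣triangular
  ... | h , eq | divides t tri≡ = w , geometric-p≡p*w , p∤w
    where
    w = 1 + p * (z′ * t + z′ * z′ * h)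
    factor : ∀ p z′ t h → p + z′ * p * (t * p) + z′ * p * (z′ * p) * h ≡ p * (1 + p * (z′ * t + z′ * z′ * h))
    factor = solve-∀ℕ
    geometric-p≡p*w : geometric (z′ * p) p ≡ p * w
    geometric-p≡p*w = trans eq (trans (cong (λ s → p + z′ * p * s + z′ * p * (z′ * p) * h) tri≡) (factor p z′ t h))
    p∤w : ¬ p ∣ w
    p∤w p∣w = ¬p∣1 p-prime (∣m+n∣m⇒∣n (subst (p ∣_) (+-comm 1 _) p∣w) (m∣m*n _))

  p∣geometric⇒p∣ : ∀ {z} q → p ∣ z → p ∣ geometric z q → p ∣ q
  p∣geometric⇒p∣ {z} q p∣z p∣geometric with geometric≡+z*triangular+z²* z q
  ... | h , eq = ∣m+n∣m⇒∣n (subst (p ∣_) (trans eq (regroup z q (triangular q) h)) p∣geometric) (∣m⇒∣m*n _ p∣z)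
    where regroup : ∀ z q t h → q + z * t + z * z * h ≡ z * (t + z * h) + q
          regroup = solve-∀ℕ

  -- As (1 + z)^q − 1 = z · geometric z q, this is v_p((1 + z)^q − 1) = v_p(z) + v_p(q) for odd p ∣ z.
  p^∣geometric⇔p^∣ : ∀ k {z} q → p ∣ z → (p ^ k ∣ geometric z q) ⇔ (p ^ k ∣ q)
  p^∣geometric⇔p^∣ zero    q _ = mk⇔ (λ _ → 1∣ q) (λ _ → 1∣ _)
  p^∣geometric⇔p^∣ (suc k) {z} q p∣z with p ∣? q
  ... | no p∤q = mk⇔ (λ h → ⊥-elim (p∤q (p∣geometric⇒p∣ q p∣z (∣-trans (m∣m*n (p ^ k)) h))))
                     (λ h → ⊥-elim (p∤q (∣-trans (m∣m*n (p ^ k)) h)))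
  ... | yes (divides q′ refl) with geometric-p≡p*unit p∣z
  ...   | w , geometric-p≡ , p∤w = begin
    (p ^ suc k ∣ geometric z (q′ * p))    ≡⟨ cong (p ^ suc k ∣_) split ⟩
    (p * p ^ k ∣ p * (w * geometric z′ q′)) ≈⟨ p*-∣-cancel⇔ p-prime ⟩
    (p ^ k ∣ w * geometric z′ q′)         ≈⟨ unit*-∣-cancel⇔ p-prime k p∤w ⟩
    (p ^ k ∣ geometric z′ q′)             ≈⟨ p^∣geometric⇔p^∣ k q′ (∣m⇒∣m*n (geometric z p) p∣z) ⟩
    (p ^ k ∣ q′)                          ≈⟨ p*-∣-cancel⇔ p-prime ⟨
    (p * p ^ k ∣ p * q′)                  ≡⟨ cong (p ^ suc k ∣_) (*-comm p q′) ⟩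
    (p ^ suc k ∣ q′ * p)                  ∎
    where
    open ⇔-Reasoning
    z′ = z * geometric z p
    split : geometric z (q′ * p) ≡ p * (w * geometric z′ q′)
    split = trans (cong (geometric z) (*-comm q′ p))
              (trans (geometric-* z p q′) (trans (cong (_* geometric z′ q′) geometric-p≡) (*-assoc p w _)))

  module _ {n : ℕ} (n≥1 : 1 ≤ n) where

    private
      N = p ^ n
      instance
        N≢0 : NonZero N
        N≢0 = m^n≢0 p n
      p∣N : p ∣ N
      p∣N = p∣p^ p n≥1

    N-1≡-1 : + (N ∸ 1) ≡ -1ℤ [mod N ]
    N-1≡-1 = mod-by (divides (+ 1) (begin
      + (N ∸ 1) -ᶻ -1ℤ     ≡⟨ ℤ.pos-+ (N ∸ 1) 1 ⟨
      + (N ∸ 1 + 1)        ≡⟨ cong +_ (m∸n+n≡m (m^n>0 p n)) ⟩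
      + N                  ≡⟨ ℤ.*-identityˡ (+ N) ⟨
      + 1 *ᶻ + N           ∎))
      where open ≡-Reasoning

    ¬p∣±1 : ∀ {ε} → ε ≡ 1 ⊎ ε ≡ N ∸ 1 → ¬ p ∣ ε
    ¬p∣±1 (inj₁ refl) = ¬p∣1 p-prime
    ¬p∣±1 (inj₂ refl) p∣ε = ¬p∣1 p-prime (∣m+n∣m⇒∣n (subst (p ∣_) (sym (m∸n+n≡m (m^n>0 p n))) p∣N) p∣ε)

    ±1^≡±1 : ∀ {ε} → ε ≡ 1 ⊎ ε ≡ N ∸ 1 → ∀ d → (+ ε) ^ᶻ d ≡ + 1 [mod N ] ⊎ (+ ε) ^ᶻ d ≡ -1ℤ [mod N ]
    ±1^≡±1 (inj₁ refl) d = inj₁ (≡-mod-reflexive (ℤ.^-zeroˡ d))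
    ±1^≡±1 (inj₂ refl) d = Data.Sum.map reduce reduce (-1^≡±1 d)
      where reduce : ∀ {c} → -1ℤ ^ᶻ d ≡ c → (+ (N ∸ 1)) ^ᶻ d ≡ c [mod N ]
            reduce eq = ≡-mod-trans (^-cong-mod d N-1≡-1) (≡-mod-reflexive eq)

    ±1²≡1 : ∀ {ε} → ε ≡ 1 ⊎ ε ≡ N ∸ 1 → (+ ε) ^ᶻ 2 ≡ + 1 [mod N ]
    ±1²≡1 (inj₁ refl) = ≡-mod-refl
    ±1²≡1 (inj₂ refl) = ^-cong-mod 2 N-1≡-1

    ±1-order∣2 : ∀ {ε oε} → ε ≡ 1 ⊎ ε ≡ N ∸ 1 → IsOrder N ε oε → oε ∣ 2
    ±1-order∣2 ε≡±1 order = Equivalence.to (^≡1⇔order∣ N order 2) (±1²≡1 ε≡±1)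

    ±1^*y≡y⇔order∣ : ∀ {ε oε y} → ε ≡ 1 ⊎ ε ≡ N ∸ 1 → IsOrder N ε oε → y ≢ 0 → y < N →
                     ∀ d → ((+ ε) ^ᶻ d *ᶻ + y ≡ + y [mod N ]) ⇔ (oε ∣ d)
    ±1^*y≡y⇔order∣ {ε} {oε} {y} ε≡±1 order y≢0 y<N d = mk⇔ to from
      where
      from : oε ∣ d → (+ ε) ^ᶻ d *ᶻ + y ≡ + y [mod N ]
      from oε∣d = ≡-mod-trans (*-congʳ-mod (+ y) (Equivalence.from (^≡1⇔order∣ N order d) oε∣d)) (≡-mod-reflexive (ℤ.*-identityˡ (+ y)))
      vy<n : val p n y < n
      vy<n = ≤∧≢⇒< (val≤n p n y) (λ vy≡n → y≢0 (val≡n⇒≡0 p n y<N vy≡n))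
      ε^d≢-1 : (+ ε) ^ᶻ d *ᶻ + y ≡ + y [mod N ] → ¬ ((+ ε) ^ᶻ d ≡ -1ℤ [mod N ])
      ε^d≢-1 h ε^d≡-1 = ¬p∣2 (∣-trans (p∣p^ p (m<n⇒0<n∸m vy<n))
                              (Equivalence.to ≡-mod⇔∣∣-∣ -1≡1))
        where
        -1≡1 : -1ℤ ≡ + 1 [mod p ^ (n ∸ val p n y) ]
        -1≡1 = ≡-mod-val-cancelʳ p-prime n n y ≤-refl (begin
          -1ℤ *ᶻ + y             ≈⟨ *-congʳ-mod (+ y) ε^d≡-1 ⟨
          (+ ε) ^ᶻ d *ᶻ + y      ≈⟨ h ⟩
          + y                    ≡⟨ ℤ.*-identityˡ (+ y) ⟨
          + 1 *ᶻ + y             ∎)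
          where open ≡-mod-Reasoning N
      to : (+ ε) ^ᶻ d *ᶻ + y ≡ + y [mod N ] → oε ∣ d
      to h = [ Equivalence.to (^≡1⇔order∣ N order d) , (λ ε^d≡-1 → ⊥-elim (ε^d≢-1 h ε^d≡-1)) ]′ (±1^≡±1 ε≡±1 d)

    module _ {α oᾱ : ℕ} (order : IsOrder p α oᾱ) where

      -- α^oᾱ − 1 reduced modulo p^n, written without subtraction as in the statement
      α^oᾱ-1 : ℕ
      α^oᾱ-1 = mod N (α ^ oᾱ + (N ∸ 1))

      private
        z = α^oᾱ-1
        v = val p n z

      α^oᾱ≡1+z : (+ α) ^ᶻ oᾱ ≡ + (1 + z) [mod N ]
      α^oᾱ≡1+z = begin
        (+ α) ^ᶻ oᾱ                      ≡⟨ pos-^ α oᾱ ⟨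
        + (α ^ oᾱ)                       ≈⟨ Equivalence.from (+-≡-mod⇔∣ (α ^ oᾱ) N) (divides 1 (sym (*-identityˡ N))) ⟨
        + (α ^ oᾱ + N)                   ≡⟨ cong +_ (trans (cong (_+_ (α ^ oᾱ)) (sym (m+[n∸m]≡n (m^n>0 p n)))) (+-suc (α ^ oᾱ) (N ∸ 1))) ⟩
        + (1 + (α ^ oᾱ + (N ∸ 1)))       ≡⟨ ℤ.pos-+ 1 _ ⟩
        + 1 +ᶻ + (α ^ oᾱ + (N ∸ 1))      ≈⟨ +-congˡ-mod (+ 1) (Equivalence.to (mod≡⇔≡-mod N z _) reduce) ⟨
        + 1 +ᶻ + z                       ≡⟨ ℤ.pos-+ 1 z ⟨
        + (1 + z)                        ∎
        where
        open ≡-mod-Reasoning N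
        reduce : mod N z ≡ mod N (α ^ oᾱ + (N ∸ 1))
        reduce = trans (mod≡% N z) (trans (cong (_% N) (mod≡% N _)) (trans (m%n%n≡m%n _ N) (sym (mod≡% N _))))

      p∣α^oᾱ-1 : p ∣ z
      p∣α^oᾱ-1 = Equivalence.to (+-≡-mod⇔∣ 1 z) (begin
        + (1 + z)     ≈⟨ ≡-mod-∣ p∣N α^oᾱ≡1+z ⟨
        (+ α) ^ᶻ oᾱ   ≈⟨ ^order≡1 p order ⟩
        + 1           ∎)
        where open ≡-mod-Reasoning p

      α^[oᾱ*q]≡1+z*geometric : ∀ q → (+ α) ^ᶻ (oᾱ * q) ≡ + (1 + z * geometric z q) [mod N ]
      α^[oᾱ*q]≡1+z*geometric q = begin
        (+ α) ^ᶻ (oᾱ * q)             ≡⟨ ℤ.^-*-assoc (+ α) oᾱ q ⟨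
        ((+ α) ^ᶻ oᾱ) ^ᶻ q            ≈⟨ ^-cong-mod q α^oᾱ≡1+z ⟩
        (+ (1 + z)) ^ᶻ q              ≡⟨ pos-^ (1 + z) q ⟨
        + ((1 + z) ^ q)               ≡⟨ cong +_ ([1+z]^≡1+z*geometric z q) ⟩
        + (1 + z * geometric z q)     ∎
        where open ≡-mod-Reasoning N

      α^[oᾱ*q]≡1⇔ : ∀ {e} q → e ≤ n → ((+ α) ^ᶻ (oᾱ * q) ≡ + 1 [mod p ^ e ]) ⇔ (p ^ (e ∸ v) ∣ q)
      α^[oᾱ*q]≡1⇔ {e} q e≤n = begin
        ((+ α) ^ᶻ (oᾱ * q) ≡ + 1 [mod p ^ e ])           ≈⟨ mk⇔ (≡-mod-trans (≡-mod-sym expand)) (≡-mod-trans expand) ⟩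
        (+ (1 + z * geometric z q) ≡ + 1 [mod p ^ e ])   ≈⟨ +-≡-mod⇔∣ 1 _ ⟩
        (p ^ e ∣ z * geometric z q)                      ≡⟨ cong (p ^ e ∣_) (*-comm z _) ⟩
        (p ^ e ∣ geometric z q * z)                      ≈⟨ mk⇔ (∣-*-val-cancelʳ p-prime n e z e≤n) (∣-val-*ʳ p n e z) ⟩
        (p ^ (e ∸ v) ∣ geometric z q)                    ≈⟨ p^∣geometric⇔p^∣ (e ∸ v) q p∣α^oᾱ-1 ⟩
        (p ^ (e ∸ v) ∣ q)                                ∎
        where
        open ⇔-Reasoning
        expand : (+ α) ^ᶻ (oᾱ * q) ≡ + (1 + z * geometric z q) [mod p ^ e ]
        expand = ≡-mod-∣ (^-monoʳ-∣ p e≤n) (α^[oᾱ*q]≡1+z*geometric q)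

      α^≡1[mod-p^e]⇔ : ∀ {e} d → 1 ≤ e → e ≤ n → ((+ α) ^ᶻ d ≡ + 1 [mod p ^ e ]) ⇔ (oᾱ * p ^ (e ∸ v) ∣ d)
      α^≡1[mod-p^e]⇔ {e} d e≥1 e≤n = mk⇔ to from
        where
        to : (+ α) ^ᶻ d ≡ + 1 [mod p ^ e ] → oᾱ * p ^ (e ∸ v) ∣ d
        to h = subst (oᾱ * p ^ (e ∸ v) ∣_) (sym d≡oᾱ*q)
                 (*-monoʳ-∣ oᾱ (Equivalence.to (α^[oᾱ*q]≡1⇔ q e≤n) (subst (λ t → (+ α) ^ᶻ t ≡ + 1 [mod p ^ e ]) d≡oᾱ*q h)))
          where
          oᾱ∣d : oᾱ ∣ d
          oᾱ∣d = Equivalence.to (^≡1⇔order∣ p order d) (≡-mod-∣ (p∣p^ p e≥1) h)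
          q : ℕ
          q = _∣_.quotient oᾱ∣d
          d≡oᾱ*q : d ≡ oᾱ * q
          d≡oᾱ*q = trans (_∣_.equality oᾱ∣d) (*-comm q oᾱ)
        from : oᾱ * p ^ (e ∸ v) ∣ d → (+ α) ^ᶻ d ≡ + 1 [mod p ^ e ]
        from (divides r d≡) = subst (λ t → (+ α) ^ᶻ t ≡ + 1 [mod p ^ e ]) (sym (trans d≡ (reorder r oᾱ (p ^ (e ∸ v)))))
                                  (Equivalence.from (α^[oᾱ*q]≡1⇔ (r * p ^ (e ∸ v)) e≤n) (n∣m*n r))
          where reorder : ∀ r o s → r * (o * s) ≡ o * (r * s)
                reorder = solve-∀ℕ

-- Counting

module _ {A : Set} where

  ∈-─ : ∀ {x z : A} {ys} (x∈ys : x ∈ ys) → z ∈ ys → z ≢ x → z ∈ ys ─ x∈ys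
  ∈-─ (here refl) (here refl) z≢x = ⊥-elim (z≢x refl)
  ∈-─ (here refl) (there z∈ys) _ = z∈ys
  ∈-─ (there x∈ys) (here refl) _ = here refl
  ∈-─ (there x∈ys) (there z∈ys) z≢x = there (∈-─ x∈ys z∈ys z≢x)

  Unique-⊆⇒length≤ : ∀ {xs ys : List A} → Unique xs → xs ⊆ ys → length xs ≤ length ys
  Unique-⊆⇒length≤ {[]} _ _ = z≤n
  Unique-⊆⇒length≤ {x ∷ xs} {ys} (x∉xs ∷ unique) xs⊆ys =
    subst (suc (length xs) ≤_) (sym (length-removeAt′ ys _))
      (s≤s (Unique-⊆⇒length≤ unique λ z∈xs → ∈-─ x∈ys (xs⊆ys (there z∈xs)) (λ { refl → All.lookup x∉xs z∈xs refl })))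
    where x∈ys = xs⊆ys (here refl)

  map⁺-Unique-on : ∀ {B : Set} (f : A → B) {xs} → (∀ {a b} → a ∈ xs → b ∈ xs → f a ≡ f b → a ≡ b) →
                   Unique xs → Unique (map f xs)
  map⁺-Unique-on f {[]} _ [] = []
  map⁺-Unique-on f {x ∷ xs} injective (x∉xs ∷ unique) =
    distinct x∉xs (λ a∈ → a∈) ∷ map⁺-Unique-on f (λ a∈ b∈ → injective (there a∈) (there b∈)) unique
    where
    distinct : ∀ {ys} → All (x ≢_) ys → ys ⊆ xs → All (f x ≢_) (map f ys)
    distinct []         _     = []
    distinct (x≢y ∷ ne) ys⊆xs =
      (λ eq → x≢y (injective (here refl) (there (ys⊆xs (here refl))) eq)) ∷ distinct ne (λ y∈ → ys⊆xs (there y∈))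

length-cartesianProduct : ∀ {A B : Set} (xs : List A) (ys : List B) → length (cartesianProduct xs ys) ≡ length xs * length ys
length-cartesianProduct []       ys = refl
length-cartesianProduct (x ∷ xs) ys =
  trans (length-++ (map (x ,_) ys)) (cong₂ _+_ (length-map (x ,_) ys) (length-cartesianProduct xs ys))

card-map≡length : ∀ {X : Set} (f g : X → ℕ × ℕ) (L S : List X) → Unique S → (∀ {a b} → a ∈ S → b ∈ S → f a ≡ f b → a ≡ b) →
            S ⊆ L → (∀ {l} → l ∈ L → f l ∈ map g S) → card (map f L) ≡ length S
card-map≡length f g L S unique injective S⊆L f[L]⊆g[S] = ≤-antisym upper lower
  where
  _≟²_ = ≡-dec _≟_ _≟_
  image = deduplicate _≟²_ (map f L)
  image⊆g[S] : ∀ {z} → z ∈ image → z ∈ map g S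
  image⊆g[S] z∈ with ∈-map⁻ f (∈-deduplicate⁻ _≟²_ (map f L) z∈)
  ... | l , l∈L , refl = f[L]⊆g[S] l∈L
  f[S]⊆image : ∀ {z} → z ∈ map f S → z ∈ image
  f[S]⊆image z∈ with ∈-map⁻ f z∈
  ... | s , s∈S , refl = ∈-deduplicate⁺ _≟²_ (∈-map⁺ f (S⊆L s∈S))
  upper : length image ≤ length S
  upper = subst (length image ≤_) (length-map g S) (Unique-⊆⇒length≤ (deduplicate-! _≟²_ (map f L)) image⊆g[S])
  lower : length S ≤ length image
  lower = subst (_≤ length image) (length-map f S) (Unique-⊆⇒length≤ (map⁺-Unique-on f injective unique) f[S]⊆image)

m∸n∸o≡m∸o∸n : ∀ m n o → m ∸ n ∸ o ≡ m ∸ o ∸ n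
m∸n∸o≡m∸o∸n m n o = trans (∸-+-assoc m n o) (trans (cong (m ∸_) (+-comm n o)) (sym (∸-+-assoc m o n)))

m∸[m∸n]≤n : ∀ m n → m ∸ (m ∸ n) ≤ n
m∸[m∸n]≤n m n with ≤-total n m
... | inj₁ n≤m = ≤-reflexive (m∸[m∸n]≡n n≤m)
... | inj₂ m≤n = ≤-trans (m∸n≤m m (m ∸ n)) m≤n

m∸[m∸n∸o]≤n+o : ∀ m n o → m ∸ (m ∸ n ∸ o) ≤ n + o
m∸[m∸n∸o]≤n+o m n o = subst (λ t → m ∸ t ≤ n + o) (sym (∸-+-assoc m n o)) (m∸[m∸n]≤n m (n + o))

∣-<⇒≡0 : ∀ {k d} → k ∣ d → d < k → d ≡ 0
∣-<⇒≡0 {d = zero}  _   _   = refl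
∣-<⇒≡0 {d = suc d} k∣d d<k = ⊥-elim (<⇒≱ d<k (∣⇒≤ k∣d))

m∸n+n≡m⊔n : ∀ m n → m ∸ n + n ≡ m ⊔ n
m∸n+n≡m⊔n m n with ≤-total n m
... | inj₁ n≤m = trans (m∸n+n≡m n≤m) (sym (m≥n⇒m⊔n≡m n≤m))
... | inj₂ m≤n = trans (cong (_+ n) (m≤n⇒m∸n≡0 m≤n)) (sym (m≤n⇒m⊔n≡n m≤n))

<m∸[m∸n] : ∀ {o m n} → o < m → o < n → o < m ∸ (m ∸ n)
<m∸[m∸n] {o} {m} {n} o<m o<n with ≤-total n m
... | inj₁ n≤m = subst (o <_) (sym (m∸[m∸n]≡n n≤m)) o<n
... | inj₂ m≤n = subst (λ t → o < m ∸ t) (sym (m≤n⇒m∸n≡0 m≤n)) o<m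

lcm≥1 : ∀ {a b} → 1 ≤ a → 1 ≤ b → 1 ≤ lcm a b
lcm≥1 {a} {b} a≥1 b≥1 = n≢0⇒n>0 λ lcm≡0 → <-irrefl (sym (a*b≡0 lcm≡0)) (*-mono-≤ a≥1 b≥1)
  where
  a*b≡0 : lcm a b ≡ 0 → a * b ≡ 0
  a*b≡0 lcm≡0 = trans (sym (gcd*lcm a b)) (trans (cong (gcd a b *_) lcm≡0) (*-zeroʳ (gcd a b)))

m∸k∸a∸b+k≡[m∸b∸a]⊔k : ∀ m k a b → m ∸ k ∸ a ∸ b + k ≡ (m ∸ b ∸ a) ⊔ k
m∸k∸a∸b+k≡[m∸b∸a]⊔k m k a b = begin
  m ∸ k ∸ a ∸ b + k   ≡⟨ cong (λ t → t ∸ b + k) (m∸n∸o≡m∸o∸n m k a) ⟩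
  m ∸ a ∸ k ∸ b + k   ≡⟨ cong (_+ k) (m∸n∸o≡m∸o∸n (m ∸ a) k b) ⟩
  m ∸ a ∸ b ∸ k + k   ≡⟨ cong (λ t → t ∸ k + k) (m∸n∸o≡m∸o∸n m a b) ⟩
  m ∸ b ∸ a ∸ k + k   ≡⟨ m∸n+n≡m⊔n (m ∸ b ∸ a) k ⟩
  (m ∸ b ∸ a) ⊔ k     ∎
  where open ≡-Reasoning

*-^-∸-merge : ∀ a p m k t s → a * p ^ (m ∸ k ∸ t ∸ s) * p ^ k ≡ a * p ^ ((m ∸ s ∸ t) ⊔ k)
*-^-∸-merge a p m k t s = begin
  a * p ^ (m ∸ k ∸ t ∸ s) * p ^ k      ≡⟨ *-assoc a _ (p ^ k) ⟩
  a * (p ^ (m ∸ k ∸ t ∸ s) * p ^ k)    ≡⟨ cong (a *_) (^-distribˡ-+-* p (m ∸ k ∸ t ∸ s) k) ⟨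
  a * p ^ (m ∸ k ∸ t ∸ s + k)          ≡⟨ cong (λ e → a * p ^ e) (m∸k∸a∸b+k≡[m∸b∸a]⊔k m k t s) ⟩
  a * p ^ ((m ∸ s ∸ t) ⊔ k)            ∎
  where open ≡-Reasoning

a≡0⊎b≡0∧b≢0⇒a≡0 : ∀ {a b} → a ≡ 0 ⊎ b ≡ 0 → b ≢ 0 → a ≡ 0
a≡0⊎b≡0∧b≢0⇒a≡0 a≡0⊎b≡0 b≢0 = [ (λ a≡0 → a≡0) , (λ b≡0 → ⊥-elim (b≢0 b≡0)) ]′ a≡0⊎b≡0

a≡0⊎b≡0∧c+b≤a⇒b≡0 : ∀ {a b c} → a ≡ 0 ⊎ b ≡ 0 → c + b ≤ a → b ≡ 0
a≡0⊎b≡0∧c+b≤a⇒b≡0 {b = b} {c} a≡0⊎b≡0 c+b≤a =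
  [ (λ a≡0 → n≤0⇒n≡0 (≤-trans (m≤n+m b c) (subst (c + b ≤_) a≡0 c+b≤a))) , (λ b≡0 → b≡0) ]′ a≡0⊎b≡0

a≡0⊎b≡0∧a<c+b⇒a<n : ∀ {a b c n} → a ≡ 0 ⊎ b ≡ 0 → 1 ≤ n → c ≤ n → a < c + b → a < n
a≡0⊎b≡0∧a<c+b⇒a<n {a} {c = c} {n} a≡0⊎b≡0 n≥1 c≤n a<c+b =
  [ (λ a≡0 → subst (_< n) (sym a≡0) n≥1)
  , (λ b≡0 → <-≤-trans (subst (λ b → a < c + b) b≡0 a<c+b) (subst (_≤ n) (sym (+-identityʳ c)) c≤n))
  ]′ a≡0⊎b≡0

n∸b∸val0≡0 : ∀ {p} n b → n ∸ b ∸ val p n 0 ≡ 0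
n∸b∸val0≡0 {p} n b = begin
  n ∸ b ∸ val p n 0  ≡⟨ cong (n ∸ b ∸_) (val-0 p n) ⟩
  n ∸ b ∸ n          ≡⟨ ∸-+-assoc n b n ⟩
  n ∸ (b + n)        ≡⟨ m≤n⇒m∸n≡0 (m≤n+m n b) ⟩
  0                  ∎
  where open ≡-Reasoning

lcm*p^∣⇔ : ∀ {p} → Prime p → ∀ {a b} s d → .{{_ : NonZero a}} → ¬ p ∣ b → ((a * p ^ s ∣ d) × (b ∣ d)) ⇔ (lcm a b * p ^ s ∣ d)
lcm*p^∣⇔ {p} p-prime {a} {b} s d p∤b = mk⇔ to from
  where
  t = _∣_.quotient (m∣lcm[m,n] a b)
  lcm≡t*a : lcm a b ≡ t * a
  lcm≡t*a = _∣_.equality (m∣lcm[m,n] a b)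
  t∣b : t ∣ b
  t∣b = *-cancelʳ-∣ a (subst₂ _∣_ lcm≡t*a (*-comm a b) (lcm-least {a} {b} (m∣m*n b) (n∣m*n a)))
  to : (a * p ^ s ∣ d) × (b ∣ d) → lcm a b * p ^ s ∣ d
  to (divides r d≡ , b∣d) = divides r′ d≡r′*[lcm*p^s]
    where
    q = r * p ^ s
    d≡q*a : d ≡ q * a
    d≡q*a = trans d≡ (reorder r a (p ^ s))
      where reorder : ∀ r a P → r * (a * P) ≡ r * P * a
            reorder = solve-∀ℕ
    t∣q : t ∣ q
    t∣q = *-cancelʳ-∣ a (subst₂ _∣_ lcm≡t*a d≡q*a (lcm-least (divides q d≡q*a) b∣d))
    q′ = _∣_.quotient t∣q
    p^s∣q′ : p ^ s ∣ q′
    p^s∣q′ = ^-∣-*-cancelʳ p-prime s (λ p∣t → p∤b (∣-trans p∣t t∣b)) (subst (p ^ s ∣_) (_∣_.equality t∣q) (n∣m*n r))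
    r′ = _∣_.quotient p^s∣q′
    d≡r′*[lcm*p^s] : d ≡ r′ * (lcm a b * p ^ s)
    d≡r′*[lcm*p^s] = begin
      d                         ≡⟨ d≡q*a ⟩
      q * a                     ≡⟨ cong (_* a) (_∣_.equality t∣q) ⟩
      q′ * t * a                ≡⟨ cong (λ u → u * t * a) (_∣_.equality p^s∣q′) ⟩
      r′ * p ^ s * t * a        ≡⟨ reorder r′ (p ^ s) t a ⟩
      r′ * (t * a * p ^ s)      ≡⟨ cong (λ l → r′ * (l * p ^ s)) lcm≡t*a ⟨
      r′ * (lcm a b * p ^ s)    ∎
      where
      open ≡-Reasoning
      reorder : ∀ r P t a → r * P * t * a ≡ r * (t * a * P)
      reorder = solve-∀ℕ
  from : lcm a b * p ^ s ∣ d → (a * p ^ s ∣ d) × (b ∣ d)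
  from h = ∣-trans (*-monoˡ-∣ (p ^ s) (m∣lcm[m,n] a b)) h , ∣-trans (∣-trans (n∣lcm[m,n] a b) (m∣m*n (p ^ s))) h

coprime-p^n⇒¬p∣ : ∀ {p n a} → Prime p → 1 ≤ n → Coprime a (p ^ n) → ¬ p ∣ a
coprime-p^n⇒¬p∣ {p} {n} p-prime n≥1 coprime p∣a =
  ¬p∣1 p-prime (subst (p ∣_) (coprime (p∣a , p∣p^ p n≥1)) ∣-refl)

-- Orbits

-- n ∸ (n ∸ b₁ ∸ v(y)) = min(n, b₁ + v(y))
DiagonalPeriod : (p n α ε b₁ x y d : ℕ) → Set
DiagonalPeriod p n α ε b₁ x y d =
  (+ α) ^ᶻ d *ᶻ + x ≡ + x [mod p ^ (n ∸ (n ∸ b₁ ∸ val p n y)) ] × (+ ε) ^ᶻ d *ᶻ + y ≡ + y [mod p ^ n ]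

module _ {p : ℕ} (p-prime : Prime p) (n α ε b₁ x y : ℕ) (p∤α : ¬ p ∣ α) (p∤ε : ¬ p ∣ ε)
         {K Lc : ℕ} (period⇔ : ∀ d → DiagonalPeriod p n α ε b₁ x y d ⇔ (K ∣ d)) (K∣Lc : K ∣ Lc) (Lc≥1 : 1 ≤ Lc) where

  private
    vy = val p n y
    k = n ∸ b₁ ∸ vy
    c = n ∸ k
    N = p ^ n
    M = p ^ k
    instance
      p≢0 : NonZero p
      p≢0 = prime⇒nonZero p-prime
      N≢0 : NonZero N
      N≢0 = m^n≢0 p n
      M≢0 : NonZero M
      M≢0 = m^n≢0 p k
      Lc≢0 : NonZero Lc
      Lc≢0 = Data.Nat.>-nonZero Lc≥1
      K≢0 : NonZero K
      K≢0 = Data.Nat.≢-nonZero λ K≡0 → Data.Nat.≢-nonZero⁻¹ Lc (0∣⇒≡0 (subst (_∣ Lc) K≡0 K∣Lc))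

    offset : ℕ → ℕ
    offset j = p ^ b₁ * j * y

    f : ℕ × ℕ → ℕ × ℕ
    f (i , j) = mod N (α ^ i * x + offset j) , mod N (ε ^ i * y)

    -- every point of the orbit is g (r , m) for exactly one r < K and m < p^k
    g : ℕ × ℕ → ℕ × ℕ
    g (r , m) = mod N (α ^ r * x + p ^ c * m) , mod N (ε ^ r * y)

    S = cartesianProduct (upTo K) (upTo M)
    L = cartesianProduct (upTo Lc) (upTo (p ^ (n ∸ b₁)))

    X = + x
    Y = + y

    p^c*M≡N : p ^ c * M ≡ N
    p^c*M≡N = trans (sym (^-distribˡ-+-* p c k)) (cong (p ^_) (m∸n+n≡m (≤-trans (m∸n≤m (n ∸ b₁) vy) (m∸n≤m n b₁))))

    offset≡0 : ∀ j → + (offset j) ≡ + 0 [mod p ^ c ]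
    offset≡0 j = Equivalence.from (+-≡-mod⇔∣ 0 (offset j)) (∣-trans (^-monoʳ-∣ p (m∸[m∸n∸o]≤n+o n b₁ vy)) p^[b₁+vy]∣offset)
      where
      p^[b₁+vy]∣offset : p ^ (b₁ + vy) ∣ offset j
      p^[b₁+vy]∣offset = subst₂ _∣_ (sym (^-distribˡ-+-* p b₁ vy)) (sym (*-assoc (p ^ b₁) j y))
                      (*-monoʳ-∣ (p ^ b₁) (∣n⇒∣m*n j (p^val∣ p n y)))

    offset-injective : ∀ {j j′} → j < M → j′ < M → + (offset j) ≡ + (offset j′) [mod N ] → j ≡ j′
    offset-injective {j} {j′} j<M j′<M h = ≡-mod-<⇒≡ (subst (λ e → + j ≡ + j′ [mod p ^ e ]) (m∸n∸o≡m∸o∸n n vy b₁) cancelled) j<M j′<M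
      where
      factor : ∀ j → + (offset j) ≡ + j *ᶻ + (p ^ b₁) *ᶻ Y
      factor j = trans (ℤ.pos-* (p ^ b₁ * j) y) (cong (_*ᶻ Y) (trans (ℤ.pos-* (p ^ b₁) j) (ℤ.*-comm (+ (p ^ b₁)) (+ j))))
      cancelled : + j ≡ + j′ [mod p ^ (n ∸ vy ∸ b₁) ]
      cancelled = ≡-mod-^-cancelʳ p (n ∸ vy) b₁ (≡-mod-val-cancelʳ p-prime n n y ≤-refl (subst₂ _≡_[mod N ] (factor j) (factor j′) h))

    exponent-injective : ∀ {i i′} → i′ ≤ i → i < K → (+ α) ^ᶻ i *ᶻ X ≡ (+ α) ^ᶻ i′ *ᶻ X [mod p ^ c ] →
                         (+ ε) ^ᶻ i *ᶻ Y ≡ (+ ε) ^ᶻ i′ *ᶻ Y [mod N ] → i ≡ i′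
    exponent-injective {i} {i′} i′≤i i<K hα hε = trans (sym i≡i′+d) (trans (cong (_+_ i′) d≡0) (+-identityʳ i′))
      where
      d = i ∸ i′
      i≡i′+d : i′ + d ≡ i
      i≡i′+d = m+[n∸m]≡n i′≤i
      d≡0 : d ≡ 0
      d≡0 = ∣-<⇒≡0 (Equivalence.to (period⇔ d)
              ( ^-period-unshift p-prime {e = c} p∤α X i′ d (subst (λ t → (+ α) ^ᶻ t *ᶻ X ≡ (+ α) ^ᶻ i′ *ᶻ X [mod p ^ c ]) (sym i≡i′+d) hα)
              , ^-period-unshift p-prime {e = n} p∤ε Y i′ d (subst (λ t → (+ ε) ^ᶻ t *ᶻ Y ≡ (+ ε) ^ᶻ i′ *ᶻ Y [mod N ]) (sym i≡i′+d) hε)))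
              (≤-<-trans (m∸n≤m i i′) i<K)

    f-injective : ∀ {a b} → a ∈ S → b ∈ S → f a ≡ f b → a ≡ b
    f-injective {i , j} {i′ , j′} a∈S b∈S fa≡fb = cong₂ _,_ i≡i′ j≡j′
      where
      bounds = ∈-cartesianProduct⁻ (upTo K) (upTo M) a∈S
      bounds′ = ∈-cartesianProduct⁻ (upTo K) (upTo M) b∈S
      hx : (+ α) ^ᶻ i *ᶻ X +ᶻ + (offset j) ≡ (+ α) ^ᶻ i′ *ᶻ X +ᶻ + (offset j′) [mod N ]
      hx = subst₂ _≡_[mod N ] (pos-^*+ α i x _) (pos-^*+ α i′ x _) (Equivalence.to (mod≡⇔≡-mod N _ _) (cong proj₁ fa≡fb))
      hε : (+ ε) ^ᶻ i *ᶻ Y ≡ (+ ε) ^ᶻ i′ *ᶻ Y [mod N ]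
      hε = subst₂ _≡_[mod N ] (pos-^* ε i y) (pos-^* ε i′ y) (Equivalence.to (mod≡⇔≡-mod N _ _) (cong proj₂ fa≡fb))
      hα : (+ α) ^ᶻ i *ᶻ X ≡ (+ α) ^ᶻ i′ *ᶻ X [mod p ^ c ]
      hα = begin
        (+ α) ^ᶻ i *ᶻ X                         ≡⟨ ℤ.+-identityʳ _ ⟨
        (+ α) ^ᶻ i *ᶻ X +ᶻ + 0                  ≈⟨ +-congˡ-mod ((+ α) ^ᶻ i *ᶻ X) (offset≡0 j) ⟨
        (+ α) ^ᶻ i *ᶻ X +ᶻ + (offset j)         ≈⟨ ≡-mod-∣ (^-monoʳ-∣ p (m∸n≤m n k)) hx ⟩
        (+ α) ^ᶻ i′ *ᶻ X +ᶻ + (offset j′)       ≈⟨ +-congˡ-mod ((+ α) ^ᶻ i′ *ᶻ X) (offset≡0 j′) ⟩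
        (+ α) ^ᶻ i′ *ᶻ X +ᶻ + 0                 ≡⟨ ℤ.+-identityʳ _ ⟩
        (+ α) ^ᶻ i′ *ᶻ X                        ∎
        where open ≡-mod-Reasoning (p ^ c)
      i≡i′ : i ≡ i′
      i≡i′ with ≤-total i′ i
      ... | inj₁ i′≤i = exponent-injective i′≤i (∈-upTo⁻ (proj₁ bounds)) hα hε
      ... | inj₂ i≤i′ = sym (exponent-injective i≤i′ (∈-upTo⁻ (proj₁ bounds′)) (≡-mod-sym hα) (≡-mod-sym hε))
      j≡j′ : j ≡ j′
      j≡j′ = offset-injective (∈-upTo⁻ (proj₂ bounds)) (∈-upTo⁻ (proj₂ bounds′))
               (+-cancelˡ-mod ((+ α) ^ᶻ i′ *ᶻ X) (subst (λ t → (+ α) ^ᶻ t *ᶻ X +ᶻ _ ≡ _ [mod N ]) i≡i′ hx))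

    f[L]⊆g[S] : ∀ {l} → l ∈ L → f l ∈ map g S
    f[L]⊆g[S] {i , j} _ = subst (_∈ map g S) (sym f≡g) (∈-map⁺ g (∈-cartesianProduct⁺ (∈-upTo⁺ (m%n<n i K)) (∈-upTo⁺ m<M)))
      where
      r = i % K
      q = i / K
      i≡r+q*K : i ≡ r + q * K
      i≡r+q*K = m≡m%n+[m/n]*n i K
      period : DiagonalPeriod p n α ε b₁ x y (q * K)
      period = Equivalence.from (period⇔ (q * K)) (n∣m*n q)
      hα : (+ α) ^ᶻ i *ᶻ X +ᶻ + (offset j) ≡ (+ α) ^ᶻ r *ᶻ X [mod p ^ c ]
      hα = begin
        (+ α) ^ᶻ i *ᶻ X +ᶻ + (offset j)   ≈⟨ +-congˡ-mod ((+ α) ^ᶻ i *ᶻ X) (offset≡0 j) ⟩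
        (+ α) ^ᶻ i *ᶻ X +ᶻ + 0            ≡⟨ ℤ.+-identityʳ _ ⟩
        (+ α) ^ᶻ i *ᶻ X                   ≡⟨ cong (λ t → (+ α) ^ᶻ t *ᶻ X) i≡r+q*K ⟩
        (+ α) ^ᶻ (r + q * K) *ᶻ X         ≈⟨ ^-period-shift (+ α) X r (q * K) (proj₁ period) ⟩
        (+ α) ^ᶻ r *ᶻ X                   ∎
        where open ≡-mod-Reasoning (p ^ c)
      hε : (+ ε) ^ᶻ i *ᶻ Y ≡ (+ ε) ^ᶻ r *ᶻ Y [mod N ]
      hε = subst (λ t → (+ ε) ^ᶻ t *ᶻ Y ≡ (+ ε) ^ᶻ r *ᶻ Y [mod N ]) (sym i≡r+q*K) (^-period-shift (+ ε) Y r (q * K) (proj₂ period))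
      lifted = lift-≡-mod (p ^ c) M hα
      m = proj₁ lifted
      m<M = proj₁ (proj₂ lifted)
      hα′ : (+ α) ^ᶻ i *ᶻ X +ᶻ + (offset j) ≡ (+ α) ^ᶻ r *ᶻ X +ᶻ + (p ^ c) *ᶻ + m [mod N ]
      hα′ = subst (λ t → (+ α) ^ᶻ i *ᶻ X +ᶻ + (offset j) ≡ (+ α) ^ᶻ r *ᶻ X +ᶻ + (p ^ c) *ᶻ + m [mod t ]) p^c*M≡N (proj₂ (proj₂ lifted))
      f≡g : f (i , j) ≡ g (r , m)
      f≡g = cong₂ _,_
        (Equivalence.from (mod≡⇔≡-mod N _ _) (subst₂ _≡_[mod N ] (sym (pos-^*+ α i x _))
          (trans (cong ((+ α) ^ᶻ r *ᶻ X +ᶻ_) (sym (ℤ.pos-* (p ^ c) m))) (sym (pos-^*+ α r x (p ^ c * m)))) hα′))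
        (Equivalence.from (mod≡⇔≡-mod N _ _) (subst₂ _≡_[mod N ] (sym (pos-^* ε i y)) (sym (pos-^* ε r y)) hε))

    S⊆L : S ⊆ L
    S⊆L s∈S with ∈-cartesianProduct⁻ (upTo K) (upTo M) s∈S
    ... | i∈ , j∈ = ∈-cartesianProduct⁺ (∈-upTo⁺ (<-≤-trans (∈-upTo⁻ i∈) (∣⇒≤ K∣Lc)))
                      (∈-upTo⁺ (<-≤-trans (∈-upTo⁻ j∈) (^-monoʳ-≤ p (m∸n≤m (n ∸ b₁) vy))))

  card-orbitD : card (orbitD p n α ε b₁ Lc x y) ≡ K * p ^ (n ∸ b₁ ∸ val p n y)
  card-orbitD = begin
    card (map f L)   ≡⟨ card-map≡length f g L S (Unique.cartesianProduct⁺ (Unique.upTo⁺ K) (Unique.upTo⁺ M)) f-injective S⊆L f[L]⊆g[S] ⟩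
    length S         ≡⟨ length-cartesianProduct (upTo K) (upTo M) ⟩
    length (upTo K) * length (upTo M) ≡⟨ cong₂ _*_ (length-upTo K) (length-upTo M) ⟩
    K * M            ∎
    where open ≡-Reasoning

module _ {p : ℕ} (p-prime : Prime p) where

  diagonalPeriod⇔-y≡0 : ∀ n α ε b₁ x {oα} → IsOrder (p ^ n) α oα → val p n x ≡ 0 →
                ∀ d → DiagonalPeriod p n α ε b₁ x 0 d ⇔ (oα ∣ d)
  diagonalPeriod⇔-y≡0 n α ε b₁ x {oα} order vx≡0 d = mk⇔ to from
    where
    α-period : ℕ → Set
    α-period e = (+ α) ^ᶻ d *ᶻ + x ≡ + x [mod p ^ e ]
    α-part : α-period n ⇔ (oα ∣ d)
    α-part = ^*x≡x⇔order∣ p-prime n order vx≡0 d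
    to : DiagonalPeriod p n α ε b₁ x 0 d → oα ∣ d
    to (hα , _) = Equivalence.to α-part (subst α-period (cong (n ∸_) (n∸b∸val0≡0 n b₁)) hα)
    from : oα ∣ d → DiagonalPeriod p n α ε b₁ x 0 d
    from oα∣d = subst α-period (sym (cong (n ∸_) (n∸b∸val0≡0 n b₁))) (Equivalence.from α-part oα∣d) , ≡-mod-reflexive (ℤ.*-zeroʳ ((+ ε) ^ᶻ d))

  diagonalPeriod⇔-b₁+vy≤vx : ∀ n α ε b₁ x y {oε} → IsOrder (p ^ n) ε oε → val p n y ≡ 0 → b₁ + val p n y ≤ val p n x →
                       ∀ d → DiagonalPeriod p n α ε b₁ x y d ⇔ (oε ∣ d)
  diagonalPeriod⇔-b₁+vy≤vx n α ε b₁ x y {oε} order vy≡0 b₁+vy≤vx d = mk⇔ to from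
    where
    c = n ∸ (n ∸ b₁ ∸ val p n y)
    ε-part : ((+ ε) ^ᶻ d *ᶻ + y ≡ + y [mod p ^ n ]) ⇔ (oε ∣ d)
    ε-part = ^*x≡x⇔order∣ p-prime n order vy≡0 d
    x≡0 : + x ≡ + 0 [mod p ^ c ]
    x≡0 = Equivalence.from (+-≡-mod⇔∣ 0 x) (∣-trans (^-monoʳ-∣ p (≤-trans (m∸[m∸n∸o]≤n+o n b₁ (val p n y)) b₁+vy≤vx)) (p^val∣ p n x))
    α-part : (+ α) ^ᶻ d *ᶻ + x ≡ + x [mod p ^ c ]
    α-part = begin
      (+ α) ^ᶻ d *ᶻ + x   ≈⟨ *-congˡ-mod ((+ α) ^ᶻ d) x≡0 ⟩
      (+ α) ^ᶻ d *ᶻ + 0   ≡⟨ ℤ.*-zeroʳ ((+ α) ^ᶻ d) ⟩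
      + 0                 ≈⟨ x≡0 ⟨
      + x                 ∎
      where open ≡-mod-Reasoning (p ^ c)
    to : DiagonalPeriod p n α ε b₁ x y d → oε ∣ d
    to (_ , hε) = Equivalence.to ε-part hε
    from : oε ∣ d → DiagonalPeriod p n α ε b₁ x y d
    from oε∣d = α-part , Equivalence.from ε-part oε∣d

module _ {p : ℕ} (p-prime : Prime p) (p-odd : ¬ 2 ∣ p) {n : ℕ} (n≥1 : 1 ≤ n) where

  diagonalPeriod⇔-vx<b₁+vy : ∀ α ε b₁ x y {oε oᾱ} (ᾱ-order : IsOrder p α oᾱ) → ε ≡ 1 ⊎ ε ≡ p ^ n ∸ 1 → IsOrder (p ^ n) ε oε →
    y ≢ 0 → y < p ^ n → val p n x < n → val p n x < b₁ + val p n y → ∀ d →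
    DiagonalPeriod p n α ε b₁ x y d ⇔
      (lcm oᾱ oε * p ^ (n ∸ (n ∸ b₁ ∸ val p n y) ∸ val p n x ∸ val p n (α^oᾱ-1 p-prime p-odd n≥1 ᾱ-order)) ∣ d)
  diagonalPeriod⇔-vx<b₁+vy α ε b₁ x y {oε} {oᾱ} ᾱ-order ε≡±1 ε-order y≢0 y<N vx<n vx<b₁+vy d = begin
    DiagonalPeriod p n α ε b₁ x y d                                           ≡⟨⟩
    (((+ α) ^ᶻ d *ᶻ + x ≡ + x [mod p ^ c ]) × ((+ ε) ^ᶻ d *ᶻ + y ≡ + y [mod p ^ n ]))
                                                                              ≈⟨ α-part ×-⇔ ±1^*y≡y⇔order∣ p-prime p-odd n≥1 ε≡±1 ε-order y≢0 y<N d ⟩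
    ((oᾱ * p ^ (c ∸ vx ∸ vα) ∣ d) × (oε ∣ d))                                 ≈⟨ lcm*p^∣⇔ p-prime (c ∸ vx ∸ vα) d p∤oε ⟩
    (lcm oᾱ oε * p ^ (c ∸ vx ∸ vα) ∣ d)                                       ∎
    where
    open ⇔-Reasoning
    instance
      oᾱ≢0 : NonZero oᾱ
      oᾱ≢0 = Data.Nat.>-nonZero (proj₁ ᾱ-order)
    c = n ∸ (n ∸ b₁ ∸ val p n y)
    vx = val p n x
    vα = val p n (α^oᾱ-1 p-prime p-odd n≥1 ᾱ-order)
    c≤n : c ≤ n
    c≤n = m∸n≤m n (n ∸ b₁ ∸ val p n y)
    vx<c : vx < c
    vx<c = subst (λ t → vx < n ∸ t) (sym (∸-+-assoc n b₁ (val p n y))) (<m∸[m∸n] vx<n vx<b₁+vy)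
    α-part : ((+ α) ^ᶻ d *ᶻ + x ≡ + x [mod p ^ c ]) ⇔ (oᾱ * p ^ (c ∸ vx ∸ vα) ∣ d)
    α-part = begin
      ((+ α) ^ᶻ d *ᶻ + x ≡ + x [mod p ^ c ])      ≈⟨ *x≡x⇔≡1 p-prime n c x ((+ α) ^ᶻ d) c≤n ⟩
      ((+ α) ^ᶻ d ≡ + 1 [mod p ^ (c ∸ vx) ])       ≈⟨ α^≡1[mod-p^e]⇔ p-prime p-odd n≥1 ᾱ-order d (m<n⇒0<n∸m vx<c) (≤-trans (m∸n≤m c vx) c≤n) ⟩
      (oᾱ * p ^ (c ∸ vx ∸ vα) ∣ d)                 ∎
    p∤oε : ¬ p ∣ oε
    p∤oε p∣oε = ¬p∣2 p-prime p-odd (∣-trans p∣oε (±1-order∣2 p-prime p-odd n≥1 ε≡±1 ε-order))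

DiagonalPeriod-lcm : ∀ p n α ε b₁ x y {oα oε} .{{_ : NonZero (p ^ n)}} → IsOrder (p ^ n) α oα → IsOrder (p ^ n) ε oε →
                     DiagonalPeriod p n α ε b₁ x y (lcm oα oε)
DiagonalPeriod-lcm p n α ε b₁ x y {oα} {oε} α-order ε-order =
  ≡-mod-∣ (^-monoʳ-∣ p (m∸n≤m n (n ∸ b₁ ∸ val p n y))) (^*≡⇐order∣ (p ^ n) α-order (+ x) (m∣lcm[m,n] oα oε)) ,
  ^*≡⇐order∣ (p ^ n) ε-order (+ y) (n∣lcm[m,n] oα oε)

orbitI≡orbitD : ∀ p n b₂ x y → orbitI p n b₂ x y ≡ orbitD p n 1 1 b₂ 1 x y
orbitI≡orbitD p n b₂ x y = begin
  orbitI p n b₂ x y                 ≡⟨ map-cong 1^0≡1 js ⟩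
  map (diagonal ∘ (0 ,_)) js        ≡⟨ map-∘ js ⟩
  map diagonal (map (0 ,_) js)      ≡⟨ cong (map diagonal) (++-identityʳ (map (0 ,_) js)) ⟨
  orbitD p n 1 1 b₂ 1 x y           ∎
  where
  open ≡-Reasoning
  js = upTo (p ^ (n ∸ b₂))
  diagonal : ℕ × ℕ → ℕ × ℕ
  diagonal (i , j) = mod (p ^ n) (1 ^ i * x + p ^ b₂ * j * y) , mod (p ^ n) (1 ^ i * y)
  1^0≡1 : ∀ j → (mod (p ^ n) (x + p ^ b₂ * j * y) , mod (p ^ n) y) ≡ diagonal (0 , j)
  1^0≡1 j = cong₂ _,_ (cong (λ t → mod (p ^ n) (t + p ^ b₂ * j * y)) (sym (*-identityˡ x))) (cong (mod (p ^ n)) (sym (*-identityˡ y)))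

card-orbitI : ∀ {p} → Prime p → ∀ n b₂ x y → card (orbitI p n b₂ x y) ≡ p ^ (n ∸ b₂ ∸ val p n y)
card-orbitI {p} p-prime n b₂ x y = begin
  card (orbitI p n b₂ x y)            ≡⟨ cong card (orbitI≡orbitD p n b₂ x y) ⟩
  card (orbitD p n 1 1 b₂ 1 x y)      ≡⟨ card-orbitD p-prime n 1 1 b₂ x y (¬p∣1 p-prime) (¬p∣1 p-prime) period⇔ (1∣ 1) ≤-refl ⟩
  1 * p ^ (n ∸ b₂ ∸ val p n y)        ≡⟨ *-identityˡ _ ⟩
  p ^ (n ∸ b₂ ∸ val p n y)            ∎
  where
  open ≡-Reasoning
  1^*≡ : ∀ {m} d X → (+ 1) ^ᶻ d *ᶻ X ≡ X [mod m ]
  1^*≡ d X = ≡-mod-reflexive (trans (cong (_*ᶻ X) (ℤ.^-zeroˡ d)) (ℤ.*-identityˡ X))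
  to : ∀ {d} → DiagonalPeriod p n 1 1 b₂ x y d → 1 ∣ d
  to {d} _ = 1∣ d
  from : ∀ {d} → 1 ∣ d → DiagonalPeriod p n 1 1 b₂ x y d
  from {d} _ = 1^*≡ d (+ x) , 1^*≡ d (+ y)
  period⇔ : ∀ d → DiagonalPeriod p n 1 1 b₂ x y d ⇔ (1 ∣ d)
  period⇔ d = mk⇔ to from

corollary6p2 : (p n α ε b₁ b₂ oα oε oᾱ x y : ℕ) →
    Prime p → ¬ (2 ∣ p) → 1 ≤ n →
    α < p ^ n → Coprime α (p ^ n) →
    (ε ≡ 1 ⊎ ε ≡ p ^ n ∸ 1) →
    b₁ ≤ b₂ → b₂ ≤ n →
    IsOrder (p ^ n) α oα → IsOrder (p ^ n) ε oε → IsOrder p α oᾱ →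
    x < p ^ n → y < p ^ n → (val p n x ≡ 0 ⊎ val p n y ≡ 0) →
    ((y ≡ 0 → card (orbitD p n α ε b₁ (lcm oα oε) x y) ≡ oα) ×
     (b₁ + val p n y ≤ val p n x →
        card (orbitD p n α ε b₁ (lcm oα oε) x y) ≡ oε * p ^ (n ∸ b₁ ∸ val p n y)) ×
     (val p n x < b₁ + val p n y → ¬ (y ≡ 0) →
        card (orbitD p n α ε b₁ (lcm oα oε) x y)
          ≡ lcm oᾱ oε * p ^ ((n ∸ val p n (mod (p ^ n) (α ^ oᾱ + (p ^ n ∸ 1))) ∸ val p n x)
                               ⊔ (n ∸ b₁ ∸ val p n y)))) ×
    card (orbitI p n b₂ x y) ≡ p ^ (n ∸ b₂ ∸ val p n y)
corollary6p2 p n α ε b₁ b₂ oα oε oᾱ x y p-prime p-odd n≥1 _ α⊥pⁿ ε≡±1 b₁≤b₂ b₂≤n α-order ε-order ᾱ-order _ y<pⁿ unit =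
  ( (λ { refl → trans (count (diagonalPeriod⇔-y≡0 p-prime n α ε b₁ x α-order (a≡0⊎b≡0∧b≢0⇒a≡0 unit val0≢0)))
                      (trans (cong (λ k → oα * p ^ k) (n∸b∸val0≡0 n b₁)) (*-identityʳ oα)) })
  , (λ b₁+vy≤vx → count (diagonalPeriod⇔-b₁+vy≤vx p-prime n α ε b₁ x y ε-order (a≡0⊎b≡0∧c+b≤a⇒b≡0 unit b₁+vy≤vx) b₁+vy≤vx))
  , (λ vx<b₁+vy y≢0 → trans
       (count (diagonalPeriod⇔-vx<b₁+vy p-prime p-odd n≥1 α ε b₁ x y ᾱ-order ε≡±1 ε-order y≢0 y<pⁿ
                 (a≡0⊎b≡0∧a<c+b⇒a<n unit n≥1 (≤-trans b₁≤b₂ b₂≤n) vx<b₁+vy) vx<b₁+vy))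
       (*-^-∸-merge (lcm oᾱ oε) p n (n ∸ b₁ ∸ val p n y) (val p n x) (val p n (α^oᾱ-1 p-prime p-odd n≥1 ᾱ-order)))) )
  , card-orbitI p-prime n b₂ x y
  where
  instance
    pⁿ≢0 : NonZero (p ^ n)
    pⁿ≢0 = m^n≢0 p n {{prime⇒nonZero p-prime}}
  val0≢0 : val p n 0 ≢ 0
  val0≢0 v0≡0 = <-irrefl (trans (sym v0≡0) (val-0 p n)) n≥1
  count : ∀ {y K} → (∀ d → DiagonalPeriod p n α ε b₁ x y d ⇔ (K ∣ d)) →
          card (orbitD p n α ε b₁ (lcm oα oε) x y) ≡ K * p ^ (n ∸ b₁ ∸ val p n y)
  count {y} period⇔ = card-orbitD p-prime n α ε b₁ x y (coprime-p^n⇒¬p∣ p-prime n≥1 α⊥pⁿ) (¬p∣±1 p-prime p-odd n≥1 ε≡±1)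
    period⇔ (Equivalence.to (period⇔ _) (DiagonalPeriod-lcm p n α ε b₁ x y α-order ε-order)) (lcm≥1 (proj₁ α-order) (proj₁ ε-order))
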